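{- For every integer $n\ge2$ and all $x,y,z$, $$Z^{\mathrm{ASM}}_{n-1}(x,y,z,1)=Z^{\mathrm{ASM}}_n(x,y,z,0),\qquad Z^{\mathrm{DPP}}_{n-1}(x,y,z,1)=Z^{\mathrm{DPP}}_n(x,y,z,0).$$
   Context: An alternating sign matrix (ASM) is a square matrix with entries in $\{0,1,-1\}$ such that in each row and column the nonzero entries alternate in sign and sum to $1$; $\mathrm{ASM}(n)$ is the set of $n\times n$ ASMs. For $A\in\mathrm{ASM}(n)$: $\nu(A)=\sum_{1\le i<i'\le n,\ 1\le j'\le j\le n}A_{ij}A_{i'j'}$; $\mu(A)$ is the number of $-1$ entries; $\rho_1(A)$ the number of $0$'s left of the $1$ in the first row; $\rho_2(A)$ the number of $0$'s right of the $1$ in the last row. A descending plane partition (DPP) is an array of positive integers (parts) $D_{ij}$, with $t\ge0$ rows, where row $i$ consists of $D_{ii},\dots,D_{i,\lambda_i+i-1}$ (length $\lambda_i$), parts weakly decreasing along rows, strictly decreasing down columns, and $D_{11}>\lambda_1\ge D_{22}>\lambda_2\ge\cdots\ge D_{tt}>\lambda_t$; the empty array is a DPP. $\mathrm{DPP}(n)$ is the set of DPPs with all parts at most $n$. For $D\in\mathrm{DPP}(n)$: $\nu(D)$ is the number of parts with $D_{ij}>j-i$; $\mu(D)$ the number of parts with $D_{ij}\le j-i$; $\rho_1(D)$ the number of parts equal to $n$; $\rho_2(D)$ the number of parts equal to $n-1$ plus the number of rows of length $n-1$. For $X\in\{\mathrm{ASM},\mathrm{DPP}\}$: $Z^{X}_n(x,y,z_1,z_2)=\sum_{E\in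 X(n)}x^{\nu(E)}y^{\mu(E)}z_1^{\rho_1(E)}z_2^{\rho_2(E)}$ (the statistics being taken with respect to the index $n$ of the set). -}

module Defs where

open import Data.Bool using (Bool; true; false; _∧_; not; if_then_else_)
open import Data.Nat as ℕ using (ℕ; zero; suc; _∸_)
import Data.Nat.Properties as ℕP
open import Data.Integer as ℤ using (ℤ; +_; -[1+_]; 1ℤ; 0ℤ; -1ℤ; ∣_∣)
import Data.Integer.Properties as ℤP
open import Data.Fin using (Fin; toℕ)
open import Data.List as L using (List; []; _∷_; length; map; concatMap; filterᵇ; foldr; allFin; upTo; drop; zipWith)
open import Data.Bool.ListAction using (and)
open import Data.Nat.ListAction using (sum)
open import Data.Vec as V using (Vec; lookup; transpose; toList)
open import Data.Product using (_×_; _,_)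
open import Relation.Nullary.Decidable using (⌊_⌋)

sumℤ : List ℤ → ℤ
sumℤ = foldr ℤ._+_ 0ℤ

countᵇ : {A : Set} → (A → Bool) → List A → ℕ
countᵇ p xs = length (filterᵇ p xs)

vecsOver : {A : Set} → List A → (k : ℕ) → List (Vec A k)
vecsOver xs zero    = V.[] ∷ []
vecsOver xs (suc k) = concatMap (λ a → map (a V.∷_) (vecsOver xs k)) xs

listsOver : {A : Set} → List A → ℕ → List (List A)
listsOver xs k = map toList (vecsOver xs k)

_==ℤ_ : ℤ → ℤ → Bool
a ==ℤ b = ⌊ a ℤ.≟ b ⌋

_==_ : ℕ → ℕ → Bool
a == b = ⌊ a ℕ.≟ b ⌋

_<ᵇ_ : ℕ → ℕ → Bool
a <ᵇ b = ⌊ a ℕ.<? b ⌋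

_≤ᵇ_ : ℕ → ℕ → Bool
a ≤ᵇ b = ⌊ a ℕ.≤? b ⌋

indexed : {A : Set} → List A → List (ℕ × A)
indexed xs = L.zip (upTo (length xs)) xs

-- n × n matrices with entries in {0, 1, -1}; entry (i , j) is
-- lookup (lookup A i) j  (row i, column j, 0-indexed)
Matrix : ℕ → Set
Matrix n = Vec (Vec ℤ n) n

entry : {n : ℕ} → Matrix n → Fin n → Fin n → ℤ
entry A i j = lookup (lookup A i) j

signs : List ℤ
signs = 0ℤ ∷ 1ℤ ∷ -1ℤ ∷ []

allSignMatrices : (n : ℕ) → List (Matrix n)
allSignMatrices n = vecsOver (vecsOver signs n) n

-- consecutive entries of a list alternate in sign (entries are ±1 here)
alternates : List ℤ → Bool
alternates []           = true
alternates (a ∷ [])     = true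
alternates (a ∷ b ∷ cs) = not (a ==ℤ b) ∧ alternates (b ∷ cs)

goodLine : List ℤ → Bool
goodLine xs = alternates nz ∧ (sumℤ nz ==ℤ 1ℤ)
  where nz = filterᵇ (λ a → not (a ==ℤ 0ℤ)) xs

isASM : {n : ℕ} → Matrix n → Bool
isASM A = and (map (λ r → goodLine (toList r)) (toList A))
        ∧ and (map (λ c → goodLine (toList c)) (toList (transpose A)))

ASM : (n : ℕ) → List (Matrix n)
ASM n = filterᵇ isASM (allSignMatrices n)

νASM : {n : ℕ} → Matrix n → ℤ
νASM {n} A =
  sumℤ (concatMap (λ i → concatMap (λ i' → concatMap (λ j → concatMap (λ j' →
      if (toℕ i <ᵇ toℕ i') ∧ (toℕ j' ≤ᵇ toℕ j)
      then (entry A i j ℤ.* entry A i' j') ∷ [] else [])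
    (allFin n)) (allFin n)) (allFin n)) (allFin n))

μASM : {n : ℕ} → Matrix n → ℕ
μASM A = sum (map (λ r → countᵇ (_==ℤ -1ℤ) (toList r)) (toList A))

zerosBeforeOne : List ℤ → ℕ
zerosBeforeOne []       = 0
zerosBeforeOne (a ∷ as) =
  if a ==ℤ 1ℤ then 0 else (if a ==ℤ 0ℤ then suc (zerosBeforeOne as) else zerosBeforeOne as)

ρ₁ASM : {n : ℕ} → Matrix n → ℕ
ρ₁ASM {zero}  A = 0
ρ₁ASM {suc n} A = zerosBeforeOne (toList (V.head A))

ρ₂ASM : {n : ℕ} → Matrix n → ℕ
ρ₂ASM {zero}  A = 0
ρ₂ASM {suc n} A = zerosBeforeOne (L.reverse (toList (V.last A)))

-- Z^ASM_n(x,y,z₁,z₂).  ν(A) ≥ 0 for every ASM, so ∣ ν(A) ∣ = ν(A).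
ZASM : ℕ → ℤ → ℤ → ℤ → ℤ → ℤ
ZASM n x y z₁ z₂ = sumℤ (map (λ A →
    x ℤ.^ ∣ νASM A ∣ ℤ.* y ℤ.^ μASM A ℤ.* z₁ ℤ.^ ρ₁ASM A ℤ.* z₂ ℤ.^ ρ₂ASM A)
  (ASM n))

-- An array with t rows; row i (1-indexed) is the list
-- D_{ii}, D_{i,i+1}, ..., D_{i,λ_i+i-1}  (so row i+1 is shifted one
-- column to the right relative to row i).
Array : Set
Array = List (List ℕ)

weaklyDecreasing : List ℕ → Bool
weaklyDecreasing []           = true
weaklyDecreasing (a ∷ [])     = true
weaklyDecreasing (a ∷ b ∷ cs) = (b ≤ᵇ a) ∧ weaklyDecreasing (b ∷ cs)

rowOK : ℕ → List ℕ → Bool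
rowOK n []       = false
rowOK n (d ∷ ds) = weaklyDecreasing (d ∷ ds)
                 ∧ and (map (λ p → (1 ≤ᵇ p) ∧ (p ≤ᵇ n)) (d ∷ ds))

-- strict decrease down columns between consecutive rows r (row i) and
-- s (row i+1): D_{i,j} > D_{i+1,j} wherever both exist.  Column j of
-- row i+1 sits at position j-i-1 of s and position j-i of r.
columnsOK : List ℕ → List ℕ → Bool
columnsOK r s = and (zipWith (λ a b → b <ᵇ a) (drop 1 r) s)

-- diagonal conditions D_{ii} > λ_i ≥ D_{i+1,i+1}
diagStrict : List ℕ → Bool
diagStrict []       = false
diagStrict (d ∷ ds) = length (d ∷ ds) <ᵇ d

diagWeak : List ℕ → List ℕ → Bool
diagWeak r []       = true
diagWeak r (d ∷ ds) = d ≤ᵇ length r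

consecutiveOK : Array → Bool
consecutiveOK []           = true
consecutiveOK (r ∷ [])     = true
consecutiveOK (r ∷ s ∷ rs) = columnsOK r s ∧ diagWeak r s ∧ consecutiveOK (s ∷ rs)

isDPP : ℕ → Array → Bool
isDPP n D = and (map (rowOK n) D) ∧ and (map diagStrict D) ∧ consecutiveOK D

-- Candidate arrays: at most n rows, each of length 1..n, parts in 1..n.
-- (Every element of DPP(n) is among them: D_{11} > D_{22} > ... ≥ 1 with
-- D_{11} ≤ n gives t ≤ n, and λ_i < D_{ii} ≤ n.)
candidateRows : ℕ → List (List ℕ)
candidateRows n = concatMap (λ k → listsOver (L.map suc (upTo n)) (suc k)) (upTo n)

candidates : ℕ → List Array
candidates n = concatMap (λ t → listsOver (candidateRows n) t) (upTo (suc n))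

DPP : ℕ → List Array
DPP n = filterᵇ (isDPP n) (candidates n)

-- all parts with their offset j - i within their row
partsWithOffset : Array → List (ℕ × ℕ)
partsWithOffset D = concatMap indexed D

νDPP : Array → ℕ
νDPP D = countᵇ (λ { (k , d) → k <ᵇ d }) (partsWithOffset D)

μDPP : Array → ℕ
μDPP D = countᵇ (λ { (k , d) → d ≤ᵇ k }) (partsWithOffset D)

ρ₁DPP : ℕ → Array → ℕ
ρ₁DPP n D = countᵇ (_== n) (L.concat D)

ρ₂DPP : ℕ → Array → ℕ
ρ₂DPP n D = countᵇ (_== (n ∸ 1)) (L.concat D) ℕ.+ countᵇ (λ r → length r == (n ∸ 1)) D

ZDPP : ℕ → ℤ → ℤ → ℤ → ℤ → ℤ
ZDPP n x y z₁ z₂ = sumℤ (map (λ D →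
    x ℤ.^ νDPP D ℤ.* y ℤ.^ μDPP D ℤ.* z₁ ℤ.^ ρ₁DPP n D ℤ.* z₂ ℤ.^ ρ₂DPP n D)
  (DPP n))

-- Putting z₂ = 0 keeps exactly the objects with ρ₂ = 0, while z₂ = 1 forgets ρ₂; so it suffices to
-- identify the objects of size n with ρ₂ = 0 with all objects of size n - 1, preserving ν, μ, ρ₁.
-- An n × n ASM with ρ₂ = 0 has a 1 in its bottom-right corner, hence zeros in the rest of its
-- last row and column: it is B ⊕ (1) for an ASM B of size n - 1.  A DPP with parts ≤ n has ρ₂ = 0
-- iff it has no part n - 1 and no row of length n - 1; raising the parts n - 1 of a DPP with
-- parts ≤ n - 1 to n is a bijection onto these, and it changes neither the order relations nor
-- the comparisons of parts with their offsets j - i, since all rows are shorter than n - 1.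

module Submission where

open import Defs
open import Data.Nat using (ℕ; _≤_; _∸_)
open import Data.Integer using (ℤ; 0ℤ; 1ℤ)
open import Data.Product using (_×_)
open import Relation.Binary.PropositionalEquality using (_≡_)

open import Data.Bool using (Bool; true; false; _∧_; not; if_then_else_)
open import Data.Bool.Properties using (∧-assoc; ∧-zeroʳ; ∧-identityʳ)
open import Data.Bool.ListAction using (and; all)
open import Data.Empty using (⊥-elim)
open import Data.Fin as Fin using (Fin; inject₁; fromℕ; toℕ)
import Data.Fin.Properties as FinP
open import Data.Integer as ℤ using (+_; -1ℤ)
import Data.Integer.Properties as ℤP
open import Data.List as L using (List; []; _∷_; _++_; map; concatMap; filterᵇ; length; upTo; tabulate)
import Data.List.Properties as LP
open import Data.List.Relation.Unary.All as All using (All; []; _∷_)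
import Data.List.Relation.Unary.All.Properties as AllP
open import Data.Nat as ℕ using (zero; suc; _+_; _<_; z≤n; s≤s)
import Data.Nat.Properties as ℕP
open import Data.Nat.ListAction using (sum)
import Data.Nat.ListAction.Properties as ℕLP
open import Data.Product using (Σ; _,_; proj₁; proj₂)
open import Data.Sum using (_⊎_; inj₁; inj₂)
open import Data.Vec as V using (Vec; _∷ʳ_)
import Data.Vec.Properties as VP
open import Function using (_∘_; id)
open import Relation.Binary.PropositionalEquality
  using (refl; sym; trans; cong; cong₂; subst; subst₂; _≢_; module ≡-Reasoning)
open import Relation.Nullary using (Dec; yes; no; ¬_)
open import Relation.Nullary.Decidable using (⌊_⌋; T?)
open import Algebra.Properties.Monoid.Sum ℤP.+-0-monoid
  using (sum-init-last; sum-cong-≗; sum-replicate-zero) renaming (sum to ∑)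

⌊⌋-true : {A : Set} (a? : Dec A) → A → ⌊ a? ⌋ ≡ true
⌊⌋-true (yes _) _ = refl
⌊⌋-true (no ¬a) a = ⊥-elim (¬a a)

⌊⌋-false : {A : Set} (a? : Dec A) → ¬ A → ⌊ a? ⌋ ≡ false
⌊⌋-false (yes a) ¬a = ⊥-elim (¬a a)
⌊⌋-false (no _)  _  = refl

⌊⌋-true⁻ : {A : Set} (a? : Dec A) → ⌊ a? ⌋ ≡ true → A
⌊⌋-true⁻ (yes a) _ = a

⌊⌋-false⁻ : {A : Set} (a? : Dec A) → ⌊ a? ⌋ ≡ false → ¬ A
⌊⌋-false⁻ (no ¬a) _ = ¬a

⌊⌋-≡-yes : {A B : Set} (a? : Dec A) (b? : Dec B) → A → B → ⌊ a? ⌋ ≡ ⌊ b? ⌋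
⌊⌋-≡-yes a? b? a b = trans (⌊⌋-true a? a) (sym (⌊⌋-true b? b))

⌊⌋-≡-no : {A B : Set} (a? : Dec A) (b? : Dec B) → ¬ A → ¬ B → ⌊ a? ⌋ ≡ ⌊ b? ⌋
⌊⌋-≡-no a? b? ¬a ¬b = trans (⌊⌋-false a? ¬a) (sym (⌊⌋-false b? ¬b))

∧-true⁻ : ∀ a {b} → a ∧ b ≡ true → a ≡ true × b ≡ true
∧-true⁻ true {true} _ = refl , refl

Bool-ext : ∀ {a b} → (a ≡ true → b ≡ true) → (b ≡ true → a ≡ true) → a ≡ b
Bool-ext {true}  {true}  _ _ = refl
Bool-ext {true}  {false} f _ = sym (f refl)
Bool-ext {false} {true}  _ g = g refl
Bool-ext {false} {false} _ _ = refl

==0-+ : ∀ a b → ((a + b) == 0) ≡ (a == 0) ∧ (b == 0)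
==0-+ zero    b = refl
==0-+ (suc a) b = refl

module _ {A : Set} where

  filterᵇ-cong-local : ∀ {p q : A → Bool} {xs} → All (λ x → p x ≡ q x) xs →
                       filterᵇ p xs ≡ filterᵇ q xs
  filterᵇ-cong-local {p} {q} {x ∷ _} (e ∷ es) with p x | q x | e
  ... | true  | true  | _ = cong (x ∷_) (filterᵇ-cong-local es)
  ... | false | false | _ = filterᵇ-cong-local es
  filterᵇ-cong-local [] = refl

  filterᵇ-cong : ∀ {p q : A → Bool} → (∀ x → p x ≡ q x) → ∀ xs → filterᵇ p xs ≡ filterᵇ q xs
  filterᵇ-cong e xs = filterᵇ-cong-local {xs = xs} (All.tabulate (λ {x} _ → e x))

  filterᵇ-none : ∀ {p : A → Bool} {xs} → All (λ x → p x ≡ false) xs → filterᵇ p xs ≡ []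
  filterᵇ-none [] = refl
  filterᵇ-none {p} {x ∷ _} (e ∷ es) with p x
  ... | false = filterᵇ-none es

  filterᵇ-all : ∀ {p : A → Bool} {xs} → All (λ x → p x ≡ true) xs → filterᵇ p xs ≡ xs
  filterᵇ-all [] = refl
  filterᵇ-all {p} {x ∷ _} (e ∷ es) with p x
  ... | true = cong (x ∷_) (filterᵇ-all es)

  filterᵇ-filterᵇ : ∀ (p q : A → Bool) xs →
                    filterᵇ p (filterᵇ q xs) ≡ filterᵇ (λ x → q x ∧ p x) xs
  filterᵇ-filterᵇ p q [] = refl
  filterᵇ-filterᵇ p q (x ∷ xs) with q x
  ... | false = filterᵇ-filterᵇ p q xs
  ... | true with p x
  ...   | true  = cong (x ∷_) (filterᵇ-filterᵇ p q xs)
  ...   | false = filterᵇ-filterᵇ p q xs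

  all-filterᵇ : ∀ (p : A → Bool) xs → All (λ x → p x ≡ true) (filterᵇ p xs)
  all-filterᵇ p [] = []
  all-filterᵇ p (x ∷ xs) with p x in eq
  ... | true  = eq ∷ all-filterᵇ p xs
  ... | false = all-filterᵇ p xs

  filterᵇ-concatMap : ∀ {B : Set} (p : A → Bool) (f : B → List A) xs →
                      filterᵇ p (concatMap f xs) ≡ concatMap (filterᵇ p ∘ f) xs
  filterᵇ-concatMap p f [] = refl
  filterᵇ-concatMap p f (x ∷ xs) =
    trans (LP.filter-++ (T? ∘ p) (f x) (concatMap f xs))
          (cong (filterᵇ p (f x) ++_) (filterᵇ-concatMap p f xs))

  filterᵇ-map : ∀ {B : Set} (p : A → Bool) (f : B → A) xs →
                filterᵇ p (map f xs) ≡ map f (filterᵇ (p ∘ f) xs)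
  filterᵇ-map p f [] = refl
  filterᵇ-map p f (x ∷ xs) with p (f x)
  ... | true  = cong (f x ∷_) (filterᵇ-map p f xs)
  ... | false = filterᵇ-map p f xs

  all⇒All : ∀ (p : A → Bool) xs → all p xs ≡ true → All (λ x → p x ≡ true) xs
  all⇒All p [] _ = []
  all⇒All p (x ∷ xs) e = proj₁ (∧-true⁻ (p x) e) ∷ all⇒All p xs (proj₂ (∧-true⁻ (p x) e))

  All⇒all : ∀ (p : A → Bool) {xs} → All (λ x → p x ≡ true) xs → all p xs ≡ true
  All⇒all p [] = refl
  All⇒all p (e ∷ es) rewrite e = All⇒all p es

  all-cong-local : ∀ {p q : A → Bool} {xs} → All (λ x → p x ≡ q x) xs → all p xs ≡ all q xs
  all-cong-local [] = refl
  all-cong-local (e ∷ es) = cong₂ _∧_ e (all-cong-local es)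

  all-++ : ∀ (p : A → Bool) xs ys → all p (xs ++ ys) ≡ all p xs ∧ all p ys
  all-++ p [] ys = refl
  all-++ p (x ∷ xs) ys = trans (cong (p x ∧_) (all-++ p xs ys)) (sym (∧-assoc (p x) _ _))

  all-concat : ∀ (p : A → Bool) xss → all p (L.concat xss) ≡ all (all p) xss
  all-concat p [] = refl
  all-concat p (xs ∷ xss) = trans (all-++ p xs (L.concat xss)) (cong (all p xs ∧_) (all-concat p xss))

  all-∧ : ∀ (p q : A → Bool) xs → all p xs ∧ all q xs ≡ all (λ x → p x ∧ q x) xs
  all-∧ p q [] = refl
  all-∧ p q (x ∷ xs) with p x | q x
  ... | true  | true  = all-∧ p q xs
  ... | true  | false = ∧-zeroʳ (all p xs)
  ... | false | _     = refl

  countᵇ-∷ : ∀ (p : A → Bool) x xs →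
             countᵇ p (x ∷ xs) ≡ (if p x then suc (countᵇ p xs) else countᵇ p xs)
  countᵇ-∷ p x xs with p x
  ... | true  = refl
  ... | false = refl

  countᵇ≡0 : ∀ (p : A → Bool) xs → (countᵇ p xs == 0) ≡ all (not ∘ p) xs
  countᵇ≡0 p [] = refl
  countᵇ≡0 p (x ∷ xs) with p x
  ... | true  = refl
  ... | false = countᵇ≡0 p xs

  countᵇ-++ : ∀ (p : A → Bool) xs ys → countᵇ p (xs ++ ys) ≡ countᵇ p xs + countᵇ p ys
  countᵇ-++ p xs ys = trans (cong length (LP.filter-++ (T? ∘ p) xs ys)) (LP.length-++ (filterᵇ p xs))

  countᵇ-cong-local : ∀ {p q : A → Bool} {xs} → All (λ x → p x ≡ q x) xs → countᵇ p xs ≡ countᵇ q xs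
  countᵇ-cong-local es = cong length (filterᵇ-cong-local es)

  countᵇ-map : ∀ {B : Set} (p : A → Bool) (f : B → A) xs → countᵇ p (map f xs) ≡ countᵇ (p ∘ f) xs
  countᵇ-map p f xs = trans (cong length (filterᵇ-map p f xs)) (LP.length-map f (filterᵇ (p ∘ f) xs))

  concatMap-cong-local : ∀ {B : Set} {f g : A → List B} {xs} → All (λ x → f x ≡ g x) xs →
                         concatMap f xs ≡ concatMap g xs
  concatMap-cong-local [] = refl
  concatMap-cong-local (e ∷ es) = cong₂ _++_ e (concatMap-cong-local es)

  concatMap-concatMap : ∀ {B C : Set} (g : B → List C) (f : A → List B) xs →
                        concatMap g (concatMap f xs) ≡ concatMap (concatMap g ∘ f) xs
  concatMap-concatMap g f [] = refl
  concatMap-concatMap g f (x ∷ xs) =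
    trans (LP.concatMap-++ g (f x) (concatMap f xs)) (cong (concatMap g (f x) ++_) (concatMap-concatMap g f xs))

  concatMap-[_] : ∀ {B : Set} (g : A → B) xs → concatMap (λ x → g x ∷ []) xs ≡ map g xs
  concatMap-[ g ] [] = refl
  concatMap-[ g ] (x ∷ xs) = cong (g x ∷_) (concatMap-[ g ] xs)

  concatMap-if : ∀ {B : Set} (p : A → Bool) (f : A → B) xs →
                 concatMap (λ x → if p x then f x ∷ [] else []) xs ≡ map f (filterᵇ p xs)
  concatMap-if p f [] = refl
  concatMap-if p f (x ∷ xs) with p x
  ... | true  = cong (f x ∷_) (concatMap-if p f xs)
  ... | false = concatMap-if p f xs

  map-if : ∀ {B : Set} b (f : A → B) {x} → map f (if b then x ∷ [] else []) ≡ (if b then f x ∷ [] else [])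
  map-if true  f = refl
  map-if false f = refl

  concatMap-∷ʳ : ∀ {B : Set} (f : A → List B) xs x → concatMap f (xs L.∷ʳ x) ≡ concatMap f xs ++ f x
  concatMap-∷ʳ f xs x = trans (LP.concatMap-++ f xs (x ∷ [])) (cong (concatMap f xs ++_) (LP.++-identityʳ (f x)))

sumℤ-++ : ∀ xs ys → sumℤ (xs ++ ys) ≡ sumℤ xs ℤ.+ sumℤ ys
sumℤ-++ [] ys = sym (ℤP.+-identityˡ _)
sumℤ-++ (x ∷ xs) ys = trans (cong (ℤ._+_ x) (sumℤ-++ xs ys)) (sym (ℤP.+-assoc x _ _))

sumℤ-at-1 : ∀ {A : Set} (h : A → ℤ) (k : A → ℕ) xs →
            sumℤ (map (λ a → h a ℤ.* 1ℤ ℤ.^ k a) xs) ≡ sumℤ (map h xs)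
sumℤ-at-1 h k xs = cong sumℤ (LP.map-cong (λ a →
  trans (cong (h a ℤ.*_) (ℤP.^-zeroˡ (k a))) (ℤP.*-identityʳ (h a))) xs)

sumℤ-at-0 : ∀ {A : Set} (h : A → ℤ) (k : A → ℕ) xs →
            sumℤ (map (λ a → h a ℤ.* 0ℤ ℤ.^ k a) xs) ≡ sumℤ (map h (filterᵇ (λ a → k a == 0) xs))
sumℤ-at-0 h k [] = refl
sumℤ-at-0 h k (x ∷ xs) with k x
... | zero  = cong₂ ℤ._+_ (ℤP.*-identityʳ (h x)) (sumℤ-at-0 h k xs)
... | suc j = trans (cong₂ ℤ._+_ (ℤP.*-zeroʳ (h x)) (sumℤ-at-0 h k xs)) (ℤP.+-identityˡ _)

sumℤ-specialise : ∀ {A B : Set} (hA : A → ℤ) (hB : B → ℤ) (ρA : A → ℕ) (ρB : B → ℕ) (F : A → B) xs ys →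
                  filterᵇ (λ b → ρB b == 0) ys ≡ map F xs → All (λ a → hB (F a) ≡ hA a) xs →
                  sumℤ (map (λ a → hA a ℤ.* 1ℤ ℤ.^ ρA a) xs) ≡ sumℤ (map (λ b → hB b ℤ.* 0ℤ ℤ.^ ρB b) ys)
sumℤ-specialise hA hB ρA ρB F xs ys ρ0≡F hF = begin
    sumℤ (map (λ a → hA a ℤ.* 1ℤ ℤ.^ ρA a) xs)
  ≡⟨ sumℤ-at-1 hA ρA xs ⟩
    sumℤ (map hA xs)
  ≡⟨ cong sumℤ (LP.map-cong-local hF) ⟨
    sumℤ (map (hB ∘ F) xs)
  ≡⟨ cong sumℤ (LP.map-∘ xs) ⟩
    sumℤ (map hB (map F xs))
  ≡⟨ cong (sumℤ ∘ map hB) ρ0≡F ⟨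
    sumℤ (map hB (filterᵇ (λ b → ρB b == 0) ys))
  ≡⟨ sumℤ-at-0 hB ρB ys ⟨
    sumℤ (map (λ b → hB b ℤ.* 0ℤ ℤ.^ ρB b) ys)
  ∎ where open ≡-Reasoning

module _ {A : Set} where

  filterᵇ-restrict : ∀ (p q : A → Bool) → (∀ x → p x ≡ true → q x ≡ true) →
                     ∀ xs → filterᵇ p xs ≡ filterᵇ p (filterᵇ q xs)
  filterᵇ-restrict p q p⇒q [] = refl
  filterᵇ-restrict p q p⇒q (x ∷ xs) with p x in px | q x in qx
  ... | true  | true  rewrite px = cong (x ∷_) (filterᵇ-restrict p q p⇒q xs)
  ... | false | true  rewrite px = filterᵇ-restrict p q p⇒q xs
  ... | false | false = filterᵇ-restrict p q p⇒q xs
  ... | true  | false with () ← trans (sym (p⇒q x px)) qx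

  filterᵇ-filterᵇ-cong : ∀ (p q r : A → Bool) → (∀ x → p x ≡ true → q x ≡ r x) →
                         ∀ xs → filterᵇ q (filterᵇ p xs) ≡ filterᵇ p (filterᵇ r xs)
  filterᵇ-filterᵇ-cong p q r q≡r [] = refl
  filterᵇ-filterᵇ-cong p q r q≡r (x ∷ xs) with p x in px | r x in rx
  ... | true  | true  rewrite px | trans (q≡r x px) rx = cong (x ∷_) (filterᵇ-filterᵇ-cong p q r q≡r xs)
  ... | true  | false rewrite trans (q≡r x px) rx = filterᵇ-filterᵇ-cong p q r q≡r xs
  ... | false | true  rewrite px = filterᵇ-filterᵇ-cong p q r q≡r xs
  ... | false | false = filterᵇ-filterᵇ-cong p q r q≡r xs

module _ {A : Set} where

  vecsOver-∷ʳ : ∀ (xs : List A) k →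
                vecsOver xs (suc k) ≡ concatMap (λ v → map (v ∷ʳ_) xs) (vecsOver xs k)
  vecsOver-∷ʳ xs zero = trans (concatMap-[ (λ a → a V.∷ V.[]) ] xs) (sym (LP.++-identityʳ _))
  vecsOver-∷ʳ xs (suc k) = begin
      concatMap (λ a → map (a V.∷_) (vecsOver xs (suc k))) xs
    ≡⟨ LP.concatMap-cong (λ a → cong (map (a V.∷_)) (vecsOver-∷ʳ xs k)) xs ⟩
      concatMap (λ a → map (a V.∷_) (concatMap (λ v → map (v ∷ʳ_) xs) (vecsOver xs k))) xs
    ≡⟨ LP.concatMap-cong (λ a → trans (LP.map-concatMap (a V.∷_) (λ v → map (v ∷ʳ_) xs) (vecsOver xs k))
                                  (LP.concatMap-cong (λ v → sym (LP.map-∘ xs)) (vecsOver xs k))) xs ⟩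
      concatMap (λ a → concatMap (λ v → map (λ b → a V.∷ (v ∷ʳ b)) xs) (vecsOver xs k)) xs
    ≡⟨ LP.concatMap-cong (λ a → LP.concatMap-map (λ w → map (w ∷ʳ_) xs) (a V.∷_) (vecsOver xs k)) xs ⟨
      concatMap (λ a → concatMap (λ w → map (w ∷ʳ_) xs) (map (a V.∷_) (vecsOver xs k))) xs
    ≡⟨ concatMap-concatMap (λ w → map (w ∷ʳ_) xs) (λ a → map (a V.∷_) (vecsOver xs k)) xs ⟨
      concatMap (λ w → map (w ∷ʳ_) xs) (vecsOver xs (suc k))
    ∎ where open ≡-Reasoning

  vecsOver-All : ∀ {P : A → Set} {xs : List A} → All P xs → ∀ k →
                 All (All P ∘ V.toList) (vecsOver xs k)
  vecsOver-All Pxs zero = [] ∷ []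
  vecsOver-All Pxs (suc k) =
    AllP.concat⁺ (AllP.map⁺ (All.map (λ pa → AllP.map⁺ (All.map (pa ∷_) (vecsOver-All Pxs k))) Pxs))

  filterᵇ-vecsOver : ∀ (p : A → Bool) xs k →
                     filterᵇ (all p ∘ V.toList) (vecsOver xs k) ≡ vecsOver (filterᵇ p xs) k
  filterᵇ-vecsOver p xs zero = refl
  filterᵇ-vecsOver p xs (suc k) = begin
      filterᵇ (all p ∘ V.toList) (concatMap (λ a → map (a V.∷_) (vecsOver xs k)) xs)
    ≡⟨ filterᵇ-concatMap (all p ∘ V.toList) _ xs ⟩
      concatMap (λ a → filterᵇ (all p ∘ V.toList) (map (a V.∷_) (vecsOver xs k))) xs
    ≡⟨ LP.concatMap-cong (λ a → filterᵇ-map (all p ∘ V.toList) (a V.∷_) (vecsOver xs k)) xs ⟩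
      concatMap (λ a → map (a V.∷_) (filterᵇ (λ v → p a ∧ all p (V.toList v)) (vecsOver xs k))) xs
    ≡⟨ guard xs ⟩
      concatMap (λ a → map (a V.∷_) (filterᵇ (all p ∘ V.toList) (vecsOver xs k))) (filterᵇ p xs)
    ≡⟨ LP.concatMap-cong (λ a → cong (map (a V.∷_)) (filterᵇ-vecsOver p xs k)) (filterᵇ p xs) ⟩
      vecsOver (filterᵇ p xs) (suc k)
    ∎ where
      open ≡-Reasoning
      guard : ∀ ys → concatMap (λ a → map (a V.∷_) (filterᵇ (λ v → p a ∧ all p (V.toList v)) (vecsOver xs k))) ys
                   ≡ concatMap (λ a → map (a V.∷_) (filterᵇ (all p ∘ V.toList) (vecsOver xs k))) (filterᵇ p ys)
      guard [] = refl
      guard (y ∷ ys) with p y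
      ... | true  = cong (map (y V.∷_) (filterᵇ (all p ∘ V.toList) (vecsOver xs k)) ++_) (guard ys)
      ... | false = trans (cong (_++ _) (cong (map (y V.∷_)) (filterᵇ-none {xs = vecsOver xs k} (All.tabulate (λ _ → refl))))) (guard ys)

  vecsOver-[_] : ∀ (x : A) k → vecsOver (x ∷ []) k ≡ V.replicate k x ∷ []
  vecsOver-[ x ] zero = refl
  vecsOver-[ x ] (suc k) rewrite vecsOver-[ x ] k = refl

vecsOver-map : ∀ {A B : Set} (f : A → B) xs k → vecsOver (map f xs) k ≡ map (V.map f) (vecsOver xs k)
vecsOver-map f xs zero = refl
vecsOver-map f xs (suc k) = begin
    concatMap (λ b → map (b V.∷_) (vecsOver (map f xs) k)) (map f xs)
  ≡⟨ LP.concatMap-map _ f xs ⟩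
    concatMap (λ a → map (f a V.∷_) (vecsOver (map f xs) k)) xs
  ≡⟨ LP.concatMap-cong (λ a → trans (cong (map (f a V.∷_)) (vecsOver-map f xs k))
                                    (trans (sym (LP.map-∘ (vecsOver xs k))) (LP.map-∘ (vecsOver xs k)))) xs ⟩
    concatMap (map (V.map f) ∘ (λ a → map (a V.∷_) (vecsOver xs k))) xs
  ≡⟨ LP.map-concatMap (V.map f) _ xs ⟨
    map (V.map f) (vecsOver xs (suc k))
  ∎ where open ≡-Reasoning

module _ {A : Set} where

  filterᵇ-listsOver : ∀ (p : A → Bool) xs k → filterᵇ (all p) (listsOver xs k) ≡ listsOver (filterᵇ p xs) k
  filterᵇ-listsOver p xs k =
    trans (filterᵇ-map (all p) V.toList (vecsOver xs k)) (cong (map V.toList) (filterᵇ-vecsOver p xs k))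

  listsOver-All : ∀ {P : A → Set} {xs : List A} → All P xs → ∀ k → All (All P) (listsOver xs k)
  listsOver-All Pxs k = AllP.map⁺ (vecsOver-All Pxs k)

  listsOver-length : ∀ (xs : List A) k → All (λ l → length l ≡ k) (listsOver xs k)
  listsOver-length xs k = AllP.map⁺ (All.tabulate (λ {v} _ → VP.length-toList v))

listsOver-map : ∀ {A B : Set} (f : A → B) xs k → listsOver (map f xs) k ≡ map (map f) (listsOver xs k)
listsOver-map f xs k = begin
    map V.toList (vecsOver (map f xs) k)
  ≡⟨ cong (map V.toList) (vecsOver-map f xs k) ⟩
    map V.toList (map (V.map f) (vecsOver xs k))
  ≡⟨ LP.map-∘ (vecsOver xs k) ⟨
    map (V.toList ∘ V.map f) (vecsOver xs k)
  ≡⟨ LP.map-cong (VP.toList-map f) (vecsOver xs k) ⟩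
    map (map f ∘ V.toList) (vecsOver xs k)
  ≡⟨ LP.map-∘ (vecsOver xs k) ⟩
    map (map f) (listsOver xs k)
  ∎ where open ≡-Reasoning

module _ {A : Set} (g : ℕ → ℕ) where

  filterᵇ-concatMap-listsOver : ∀ (p : A → Bool) xs ns →
    filterᵇ (all p) (concatMap (listsOver xs ∘ g) ns) ≡ concatMap (listsOver (filterᵇ p xs) ∘ g) ns
  filterᵇ-concatMap-listsOver p xs ns =
    trans (filterᵇ-concatMap (all p) (listsOver xs ∘ g) ns)
          (LP.concatMap-cong (λ k → filterᵇ-listsOver p xs (g k)) ns)

  concatMap-listsOver-map : ∀ {B : Set} (f : A → B) xs ns →
    concatMap (listsOver (map f xs) ∘ g) ns ≡ map (map f) (concatMap (listsOver xs ∘ g) ns)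
  concatMap-listsOver-map f xs ns =
    trans (LP.concatMap-cong (λ k → listsOver-map f xs (g k)) ns)
          (sym (LP.map-concatMap (map f) (listsOver xs ∘ g) ns))

-- Descending plane partitions

parts : ℕ → List ℕ
parts k = map suc (upTo k)

parts-bounded : ∀ k → All (_≤ k) (parts k)
parts-bounded k = AllP.map⁺ (AllP.all-upTo k)

parts-∷ʳ : ∀ k → parts (suc k) ≡ parts k L.∷ʳ suc k
parts-∷ʳ k = trans (cong (map suc) (sym (LP.upTo-∷ʳ k))) (LP.map-++ suc (upTo k) (k ∷ []))

rowLength-bound : ∀ k r → rowOK (suc k) r ≡ true → diagStrict r ≡ true → length r ≤ k
rowLength-bound k (d ∷ ds) ok strict =
  let inRange = proj₁ (∧-true⁻ _ (proj₂ (∧-true⁻ (weaklyDecreasing (d ∷ ds)) ok)))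
      d≤n = ⌊⌋-true⁻ (d ℕ.≤? suc k) (proj₂ (∧-true⁻ (1 ≤ᵇ d) inRange))
      ℓ<d = ⌊⌋-true⁻ (suc (length ds) ℕ.<? d) strict
  in ℕP.≤-pred (ℕP.≤-trans ℓ<d d≤n)

isDPP⇒rows : ∀ k D → isDPP k D ≡ true →
             all (rowOK k) D ≡ true × all diagStrict D ≡ true × consecutiveOK D ≡ true
isDPP⇒rows k D e = let (rows , rest) = ∧-true⁻ (and (map (rowOK k) D)) e in rows , ∧-true⁻ (and (map diagStrict D)) rest

isDPP⇒rowLengths : ∀ k D → isDPP (suc k) D ≡ true → All (λ r → length r ≤ k) D
isDPP⇒rowLengths k D e =
  let (rows , strict , _) = isDPP⇒rows (suc k) D e
  in All.zipWith (λ {r} (ok , strict) → rowLength-bound k r ok strict) (all⇒All _ D rows , all⇒All _ D strict)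

-- D₁₁ > λ₁ ≥ D₂₂ > λ₂ ≥ ⋯ ≥ Dₜₜ > λₜ ≥ 1: the diagonal drops strictly, so λ₁ ≥ t - 1.
isDPP⇒rowCount : ∀ r rs → all diagStrict (r ∷ rs) ≡ true → consecutiveOK (r ∷ rs) ≡ true →
                 length rs ≤ length r
isDPP⇒rowCount r [] _ _ = z≤n
isDPP⇒rowCount r ((d ∷ ds) ∷ rs) strict cons =
  let strict′ = proj₂ (∧-true⁻ (diagStrict r) strict)
      (_ , cons′) = ∧-true⁻ (columnsOK r (d ∷ ds)) cons
      (weak , cons″) = ∧-true⁻ (diagWeak r (d ∷ ds)) cons′
      ℓ<d = ⌊⌋-true⁻ (suc (length ds) ℕ.<? d) (proj₁ (∧-true⁻ (diagStrict (d ∷ ds)) strict′))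
      d≤λ = ⌊⌋-true⁻ (d ℕ.≤? length r) weak
  in ℕP.≤-trans (s≤s (isDPP⇒rowCount (d ∷ ds) rs strict′ cons″)) (ℕP.≤-trans ℓ<d d≤λ)
isDPP⇒rowCount r ([] ∷ rs) strict _ with () ← proj₂ (∧-true⁻ (diagStrict r) strict)

lengthAtMost : ℕ → List ℕ → Bool
lengthAtMost m r = length r ≤ᵇ m

rowsUpTo : List ℕ → ℕ → List (List ℕ)
rowsUpTo xs n = concatMap (listsOver xs ∘ suc) (upTo n)

filterᵇ-lengthAtMost-rowsUpTo : ∀ m (xs : List ℕ) j →
                         filterᵇ (lengthAtMost m) (rowsUpTo xs (j + m)) ≡ rowsUpTo xs m
filterᵇ-lengthAtMost-rowsUpTo m xs zero =
  trans (filterᵇ-concatMap (lengthAtMost m) (listsOver xs ∘ suc) (upTo m))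
        (concatMap-cong-local (AllP.applyUpTo⁺₁ id m (λ {k} k<m →
          filterᵇ-all (All.map (λ {l} ℓ≡k → ⌊⌋-true (length l ℕ.≤? m) (subst (_≤ m) (sym ℓ≡k) k<m))
                               (listsOver-length xs (suc k))))))
filterᵇ-lengthAtMost-rowsUpTo m xs (suc j) = begin
    filterᵇ (lengthAtMost m) (concatMap f (upTo (suc (j + m))))
  ≡⟨ cong (filterᵇ (lengthAtMost m) ∘ concatMap f) (LP.upTo-∷ʳ (j + m)) ⟨
    filterᵇ (lengthAtMost m) (concatMap f (upTo (j + m) L.∷ʳ (j + m)))
  ≡⟨ cong (filterᵇ (lengthAtMost m)) (concatMap-∷ʳ f (upTo (j + m)) (j + m)) ⟩
    filterᵇ (lengthAtMost m) (rowsUpTo xs (j + m) ++ f (j + m))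
  ≡⟨ LP.filter-++ (T? ∘ lengthAtMost m) (rowsUpTo xs (j + m)) (f (j + m)) ⟩
    filterᵇ (lengthAtMost m) (rowsUpTo xs (j + m)) ++ filterᵇ (lengthAtMost m) (f (j + m))
  ≡⟨ cong₂ _++_ (filterᵇ-lengthAtMost-rowsUpTo m xs j)
       (filterᵇ-none (All.map (λ {l} ℓ≡ → ⌊⌋-false (length l ℕ.≤? m) (λ ℓ≤m → ℕP.m+n≮n j m (subst (_≤ m) ℓ≡ ℓ≤m)))
                              (listsOver-length xs (suc (j + m))))) ⟩
    rowsUpTo xs m ++ []
  ≡⟨ LP.++-identityʳ _ ⟩
    rowsUpTo xs m
  ∎ where
    open ≡-Reasoning
    f = listsOver xs ∘ suc

-- M = n - 1 and N = n.  Raising every part M to N changes none of the order relations that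
-- define a DPP, provided all parts are ≤ M and all rows are shorter than M.
module Bump (m : ℕ) where

  M N : ℕ
  M = suc m
  N = suc M

  bump : ℕ → ℕ
  bump d = if d == M then N else d

  data BumpView (d : ℕ) : Set where
    top   : d ≡ M → bump d ≡ N → BumpView d
    below : d ≢ M → bump d ≡ d → BumpView d

  bumpView : ∀ d → BumpView d
  bumpView d with d ℕ.≟ M
  ... | yes d≡M = top d≡M (cong (if_then N else d) (⌊⌋-true (d ℕ.≟ M) d≡M))
  ... | no  d≢M = below d≢M (cong (if_then N else d) (⌊⌋-false (d ℕ.≟ M) d≢M))

  ≤M∧≢M⇒≤m : ∀ {d} → d ≤ M → d ≢ M → d ≤ m
  ≤M∧≢M⇒≤m d≤M d≢M = ℕP.≤-pred (ℕP.≤∧≢⇒< d≤M d≢M)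

  bump-≤ᵇ-bump : ∀ a b → a ≤ M → b ≤ M → (bump b ≤ᵇ bump a) ≡ (b ≤ᵇ a)
  bump-≤ᵇ-bump a b a≤M b≤M with bumpView a | bumpView b
  ... | top refl ea | top refl eb rewrite ea = ⌊⌋-≡-yes _ _ ℕP.≤-refl ℕP.≤-refl
  ... | top refl ea | below _ eb rewrite ea | eb = ⌊⌋-≡-yes _ _ (ℕP.m≤n⇒m≤1+n b≤M) b≤M
  ... | below a≢M ea | top refl eb rewrite ea | eb =
        ⌊⌋-≡-no _ _ (λ N≤a → ℕP.≤⇒≯ a≤M (ℕP.<-≤-trans (ℕP.n<1+n M) N≤a))
                    (λ M≤a → ℕP.≤⇒≯ (≤M∧≢M⇒≤m a≤M a≢M) M≤a)
  ... | below _ ea | below _ eb rewrite ea | eb = refl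

  bump-<ᵇ-bump : ∀ a b → a ≤ M → b ≤ M → (bump b <ᵇ bump a) ≡ (b <ᵇ a)
  bump-<ᵇ-bump a b a≤M b≤M with bumpView a | bumpView b
  ... | top refl ea | top refl eb rewrite ea = ⌊⌋-≡-no _ _ (ℕP.n≮n _) (ℕP.n≮n _)
  ... | top refl ea | below b≢M eb rewrite ea | eb =
        ⌊⌋-≡-yes _ _ (ℕP.m<n⇒m<1+n (s≤s (≤M∧≢M⇒≤m b≤M b≢M))) (s≤s (≤M∧≢M⇒≤m b≤M b≢M))
  ... | below _ ea | top refl eb rewrite ea | eb =
        ⌊⌋-≡-no _ _ (λ N<a → ℕP.≤⇒≯ a≤M (ℕP.<-trans (ℕP.n<1+n M) N<a)) (ℕP.≤⇒≯ a≤M)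
  ... | below _ ea | below _ eb rewrite ea | eb = refl

  <ᵇ-bump : ∀ ℓ d → ℓ ≤ m → (ℓ <ᵇ bump d) ≡ (ℓ <ᵇ d)
  <ᵇ-bump ℓ d ℓ≤m with bumpView d
  ... | top refl e rewrite e = ⌊⌋-≡-yes _ _ (ℕP.m<n⇒m<1+n (s≤s ℓ≤m)) (s≤s ℓ≤m)
  ... | below _ e rewrite e = refl

  bump-≤ᵇ : ∀ ℓ d → ℓ ≤ m → (bump d ≤ᵇ ℓ) ≡ (d ≤ᵇ ℓ)
  bump-≤ᵇ ℓ d ℓ≤m with bumpView d
  ... | top refl e rewrite e =
        ⌊⌋-≡-no _ _ (λ N≤ℓ → ℕP.n≮n m (ℕP.≤-trans (ℕP.n≤1+n M) (ℕP.≤-trans N≤ℓ ℓ≤m)))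
                    (λ M≤ℓ → ℕP.n≮n m (ℕP.≤-trans M≤ℓ ℓ≤m))
  ... | below _ e rewrite e = refl

  bump-==N : ∀ d → d ≤ M → (bump d == N) ≡ (d == M)
  bump-==N d d≤M with bumpView d
  ... | top refl e rewrite e = ⌊⌋-≡-yes _ _ refl refl
  ... | below d≢M e rewrite e = ⌊⌋-≡-no _ _ (λ d≡N → ℕP.≤⇒≯ d≤M (subst (M <_) (sym d≡N) (ℕP.n<1+n M))) d≢M

  bump-inRange : ∀ d → d ≤ M → ((1 ≤ᵇ bump d) ∧ (bump d ≤ᵇ N)) ≡ ((1 ≤ᵇ d) ∧ (d ≤ᵇ M))
  bump-inRange d d≤M with bumpView d
  ... | top refl e rewrite e = ⌊⌋-≡-yes (N ℕ.≤? N) (M ℕ.≤? M) ℕP.≤-refl ℕP.≤-refl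
  ... | below _ e rewrite e = cong ((1 ≤ᵇ d) ∧_) (⌊⌋-≡-yes _ _ (ℕP.m≤n⇒m≤1+n d≤M) d≤M)

  BoundedRow : List ℕ → Set
  BoundedRow r = All (_≤ M) r × length r ≤ m

  bumpArray : Array → Array
  bumpArray = map (map bump)

  weaklyDecreasing-bump : ∀ r → All (_≤ M) r → weaklyDecreasing (map bump r) ≡ weaklyDecreasing r
  weaklyDecreasing-bump [] _ = refl
  weaklyDecreasing-bump (a ∷ []) _ = refl
  weaklyDecreasing-bump (a ∷ b ∷ cs) (a≤M ∷ b≤M ∷ cs≤M) =
    cong₂ _∧_ (bump-≤ᵇ-bump a b a≤M b≤M) (weaklyDecreasing-bump (b ∷ cs) (b≤M ∷ cs≤M))

  rowOK-bump : ∀ r → All (_≤ M) r → rowOK N (map bump r) ≡ rowOK M r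
  rowOK-bump [] _ = refl
  rowOK-bump (d ∷ ds) r≤M = cong₂ _∧_ (weaklyDecreasing-bump (d ∷ ds) r≤M)
    (cong and (trans (sym (LP.map-∘ (d ∷ ds))) (LP.map-cong-local (All.map (bump-inRange _) r≤M))))

  diagStrict-bump : ∀ r → BoundedRow r → diagStrict (map bump r) ≡ diagStrict r
  diagStrict-bump [] _ = refl
  diagStrict-bump (d ∷ ds) (_ , ℓ≤m) rewrite LP.length-map bump ds = <ᵇ-bump (suc (length ds)) d ℓ≤m

  columnsOK-bump : ∀ r s → All (_≤ M) r → All (_≤ M) s → columnsOK (map bump r) (map bump s) ≡ columnsOK r s
  columnsOK-bump [] s _ _ = refl
  columnsOK-bump (_ ∷ r) s (_ ∷ r≤M) s≤M = cong and (zipWith-bump r s r≤M s≤M)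
    where
      zipWith-bump : ∀ xs ys → All (_≤ M) xs → All (_≤ M) ys →
                     L.zipWith (λ a b → b <ᵇ a) (map bump xs) (map bump ys) ≡ L.zipWith (λ a b → b <ᵇ a) xs ys
      zipWith-bump (x ∷ xs) (y ∷ ys) (x≤M ∷ xs≤M) (y≤M ∷ ys≤M) =
        cong₂ _∷_ (bump-<ᵇ-bump x y x≤M y≤M) (zipWith-bump xs ys xs≤M ys≤M)
      zipWith-bump [] _ _ _ = refl
      zipWith-bump (_ ∷ _) [] _ _ = refl

  diagWeak-bump : ∀ r s → BoundedRow r → All (_≤ M) s → diagWeak (map bump r) (map bump s) ≡ diagWeak r s
  diagWeak-bump r [] _ _ = refl
  diagWeak-bump r (d ∷ _) (_ , ℓ≤m) _ rewrite LP.length-map bump r = bump-≤ᵇ (length r) d ℓ≤m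

  consecutiveOK-bump : ∀ D → All BoundedRow D → consecutiveOK (bumpArray D) ≡ consecutiveOK D
  consecutiveOK-bump [] _ = refl
  consecutiveOK-bump (r ∷ []) _ = refl
  consecutiveOK-bump (r ∷ s ∷ rs) (r-ok ∷ s-ok ∷ rs-ok) =
    cong₂ _∧_ (columnsOK-bump r s (proj₁ r-ok) (proj₁ s-ok))
      (cong₂ _∧_ (diagWeak-bump r s r-ok (proj₁ s-ok)) (consecutiveOK-bump (s ∷ rs) (s-ok ∷ rs-ok)))

  isDPP-bump : ∀ D → All BoundedRow D → isDPP N (bumpArray D) ≡ isDPP M D
  isDPP-bump D ok = cong₂ _∧_
    (cong and (trans (sym (LP.map-∘ D)) (LP.map-cong-local (All.map (λ {r} → rowOK-bump r ∘ proj₁) ok))))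
    (cong₂ _∧_
      (cong and (trans (sym (LP.map-∘ D)) (LP.map-cong-local (All.map (λ {r} → diagStrict-bump r) ok))))
      (consecutiveOK-bump D ok))

  countᵇ-offsets-bump : ∀ (p : ℕ × ℕ → Bool) → (∀ k d → k ≤ m → p (k , bump d) ≡ p (k , d)) →
                        ∀ D → All BoundedRow D →
                        countᵇ p (partsWithOffset (bumpArray D)) ≡ countᵇ p (partsWithOffset D)
  countᵇ-offsets-bump p p-bump [] _ = refl
  countᵇ-offsets-bump p p-bump (r ∷ D) ((_ , ℓ≤m) ∷ D-ok) = begin
      countᵇ p (indexed (map bump r) ++ partsWithOffset (bumpArray D))
    ≡⟨ countᵇ-++ p (indexed (map bump r)) _ ⟩
      countᵇ p (indexed (map bump r)) + countᵇ p (partsWithOffset (bumpArray D))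
    ≡⟨ cong₂ _+_ row (countᵇ-offsets-bump p p-bump D D-ok) ⟩
      countᵇ p (indexed r) + countᵇ p (partsWithOffset D)
    ≡⟨ countᵇ-++ p (indexed r) _ ⟨
      countᵇ p (indexed r ++ partsWithOffset D)
    ∎ where
      open ≡-Reasoning
      zip-bump : ∀ ks xs → All (_≤ m) ks → countᵇ p (L.zip ks (map bump xs)) ≡ countᵇ p (L.zip ks xs)
      zip-bump (k ∷ ks) (x ∷ xs) (k≤m ∷ ks≤m) =
        trans (countᵇ-∷ p (k , bump x) _)
          (trans (cong₂ (λ b c → if b then suc c else c) (p-bump k x k≤m) (zip-bump ks xs ks≤m))
            (sym (countᵇ-∷ p (k , x) _)))
      zip-bump [] _ _ = refl
      zip-bump (_ ∷ _) [] _ = refl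
      row : countᵇ p (indexed (map bump r)) ≡ countᵇ p (indexed r)
      row rewrite LP.length-map bump r =
        zip-bump (upTo (length r)) r (AllP.applyUpTo⁺₁ id (length r) (λ i<ℓ → ℕP.≤-trans (ℕP.<⇒≤ i<ℓ) ℓ≤m))

  νDPP-bump : ∀ D → All BoundedRow D → νDPP (bumpArray D) ≡ νDPP D
  νDPP-bump = countᵇ-offsets-bump _ (λ k d k≤m → <ᵇ-bump k d k≤m)

  μDPP-bump : ∀ D → All BoundedRow D → μDPP (bumpArray D) ≡ μDPP D
  μDPP-bump = countᵇ-offsets-bump _ (λ k d k≤m → bump-≤ᵇ k d k≤m)

  ρ₁DPP-bump : ∀ D → All BoundedRow D → ρ₁DPP N (bumpArray D) ≡ ρ₁DPP M D
  ρ₁DPP-bump D ok = begin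
      countᵇ (_== N) (L.concat (map (map bump) D))
    ≡⟨ cong (countᵇ (_== N)) (LP.concat-map D) ⟩
      countᵇ (_== N) (map bump (L.concat D))
    ≡⟨ countᵇ-map (_== N) bump (L.concat D) ⟩
      countᵇ ((_== N) ∘ bump) (L.concat D)
    ≡⟨ countᵇ-cong-local (All.map (bump-==N _) (AllP.concat⁺ (All.map proj₁ ok))) ⟩
      countᵇ (_== M) (L.concat D)
    ∎ where open ≡-Reasoning

  notM : ℕ → Bool
  notM d = not (d == M)

  admissible : List ℕ → Bool
  admissible r = all notM r ∧ lengthAtMost m r

  ρ₂DPP≡0 : ∀ D → isDPP N D ≡ true → (ρ₂DPP N D == 0) ≡ all admissible D
  ρ₂DPP≡0 D D∈DPP = begin
      (countᵇ (_== M) (L.concat D) + countᵇ (λ r → length r == M) D) == 0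
    ≡⟨ ==0-+ (countᵇ (_== M) (L.concat D)) _ ⟩
      (countᵇ (_== M) (L.concat D) == 0) ∧ (countᵇ (λ r → length r == M) D == 0)
    ≡⟨ cong₂ _∧_ (trans (countᵇ≡0 (_== M) (L.concat D)) (all-concat notM D))
                 (trans (countᵇ≡0 (λ r → length r == M) D)
                        (all-cong-local (All.map (λ {r} → ≢M⇔lengthAtMost r) (isDPP⇒rowLengths M D D∈DPP)))) ⟩
      all (all notM) D ∧ all (lengthAtMost m) D
    ≡⟨ all-∧ (all notM) (lengthAtMost m) D ⟩
      all admissible D
    ∎ where
      open ≡-Reasoning
      ≢M⇔lengthAtMost : ∀ r → length r ≤ M → not (length r == M) ≡ lengthAtMost m r
      ≢M⇔lengthAtMost r ℓ≤M with length r ℕ.≟ M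
      ... | yes ℓ≡M = sym (⌊⌋-false (length r ℕ.≤? m) (λ ℓ≤m → ℕP.n≮n m (subst (_≤ m) ℓ≡M ℓ≤m)))
      ... | no  ℓ≢M = sym (⌊⌋-true (length r ℕ.≤? m) (≤M∧≢M⇒≤m ℓ≤M ℓ≢M))

  boundedRows : List (List ℕ)
  boundedRows = rowsUpTo (parts M) m

  arraysUpTo : ℕ → List Array
  arraysUpTo t = concatMap (listsOver boundedRows) (upTo t)

  boundedArrays : List Array
  boundedArrays = arraysUpTo (suc M)

  boundedRows-bounded : All BoundedRow boundedRows
  boundedRows-bounded = AllP.concat⁺ (AllP.map⁺ (AllP.applyUpTo⁺₁ id m (λ {k} k<m →
    All.zipWith (λ {r} (r≤M , ℓ≡k) → r≤M , subst (_≤ m) (sym ℓ≡k) k<m)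
                (listsOver-All (parts-bounded M) (suc k) , listsOver-length (parts M) (suc k)))))

  arraysUpTo-bounded : ∀ t → All (All BoundedRow) (arraysUpTo t)
  arraysUpTo-bounded t = AllP.concat⁺ (AllP.map⁺ (AllP.applyUpTo⁺₂ id t (listsOver-All boundedRows-bounded)))

  DPP-bounded : DPP M ≡ filterᵇ (isDPP M) boundedArrays
  DPP-bounded = begin
      filterᵇ (isDPP M) (candidates M)
    ≡⟨ filterᵇ-restrict (isDPP M) (all (lengthAtMost m)) rows-lengthAtMost (candidates M) ⟩
      filterᵇ (isDPP M) (filterᵇ (all (lengthAtMost m)) (candidates M))
    ≡⟨ cong (filterᵇ (isDPP M)) (filterᵇ-concatMap-listsOver id (lengthAtMost m) (candidateRows M) (upTo (suc M))) ⟩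
      filterᵇ (isDPP M) (concatMap (listsOver (filterᵇ (lengthAtMost m) (candidateRows M))) (upTo (suc M)))
    ≡⟨ cong (λ rows → filterᵇ (isDPP M) (concatMap (listsOver rows) (upTo (suc M))))
            (filterᵇ-lengthAtMost-rowsUpTo m (parts M) 1) ⟩
      filterᵇ (isDPP M) boundedArrays
    ∎ where
      open ≡-Reasoning
      rows-lengthAtMost : ∀ D → isDPP M D ≡ true → all (lengthAtMost m) D ≡ true
      rows-lengthAtMost D D∈DPP = All⇒all (lengthAtMost m) (All.map (⌊⌋-true (_ ℕ.≤? m)) (isDPP⇒rowLengths m D D∈DPP))

  DPP-bounded-rows : All (All BoundedRow) (DPP M)
  DPP-bounded-rows = subst (All (All BoundedRow)) (sym DPP-bounded)
                           (AllP.filter⁺ (T? ∘ isDPP M) (arraysUpTo-bounded (suc M)))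

  parts-admissible : filterᵇ notM (parts N) ≡ map bump (parts M)
  parts-admissible = begin
      filterᵇ notM (parts N)
    ≡⟨ cong (filterᵇ notM) (trans (parts-∷ʳ M) (cong (L._∷ʳ N) (parts-∷ʳ m))) ⟩
      filterᵇ notM ((parts m L.∷ʳ M) L.∷ʳ N)
    ≡⟨ trans (LP.filter-++ (T? ∘ notM) (parts m L.∷ʳ M) (N ∷ []))
             (cong (_++ filterᵇ notM (N ∷ [])) (LP.filter-++ (T? ∘ notM) (parts m) (M ∷ []))) ⟩
      (filterᵇ notM (parts m) ++ filterᵇ notM (M ∷ [])) ++ filterᵇ notM (N ∷ [])
    ≡⟨ cong₂ _++_ (cong₂ _++_ (filterᵇ-all (All.map notM-small (parts-bounded m)))
                              (filterᵇ-none {p = notM} (cong not (⌊⌋-true (M ℕ.≟ M) refl) ∷ [])))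
                  (filterᵇ-all {p = notM} (cong not (⌊⌋-false (N ℕ.≟ M) (ℕP.1+n≢n {M})) ∷ [])) ⟩
      (parts m ++ []) L.∷ʳ N
    ≡⟨ cong₂ _++_ (LP.++-identityʳ (parts m)) (cong (_∷ []) (sym bump-M)) ⟩
      parts m L.∷ʳ bump M
    ≡⟨ cong (L._∷ʳ bump M) (LP.map-id-local (All.map bump-small (parts-bounded m))) ⟨
      map bump (parts m) L.∷ʳ bump M
    ≡⟨ trans (cong (map bump) (parts-∷ʳ m)) (LP.map-++ bump (parts m) (M ∷ [])) ⟨
      map bump (parts M)
    ∎ where
      open ≡-Reasoning
      ≤m⇒≢M : ∀ {d} → d ≤ m → d ≢ M
      ≤m⇒≢M d≤m d≡M = ℕP.n≮n m (subst (_≤ m) d≡M d≤m)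
      notM-small : ∀ {d} → d ≤ m → notM d ≡ true
      notM-small {d} d≤m = cong not (⌊⌋-false (d ℕ.≟ M) (≤m⇒≢M d≤m))
      bump-small : ∀ {d} → d ≤ m → bump d ≡ d
      bump-small {d} d≤m with bumpView d
      ... | top d≡M _ = ⊥-elim (≤m⇒≢M d≤m d≡M)
      ... | below _ e = e
      bump-M : bump M ≡ N
      bump-M with bumpView M
      ... | top _ e = e
      ... | below M≢M _ = ⊥-elim (M≢M refl)

  candidateRows-admissible : filterᵇ admissible (candidateRows N) ≡ map (map bump) boundedRows
  candidateRows-admissible = begin
      filterᵇ admissible (candidateRows N)
    ≡⟨ filterᵇ-filterᵇ (lengthAtMost m) (all notM) (candidateRows N) ⟨
      filterᵇ (lengthAtMost m) (filterᵇ (all notM) (rowsUpTo (parts N) N))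
    ≡⟨ cong (filterᵇ (lengthAtMost m)) (filterᵇ-concatMap-listsOver suc notM (parts N) (upTo N)) ⟩
      filterᵇ (lengthAtMost m) (rowsUpTo (filterᵇ notM (parts N)) N)
    ≡⟨ cong (λ xs → filterᵇ (lengthAtMost m) (rowsUpTo xs N)) parts-admissible ⟩
      filterᵇ (lengthAtMost m) (rowsUpTo (map bump (parts M)) N)
    ≡⟨ cong (filterᵇ (lengthAtMost m)) (concatMap-listsOver-map suc bump (parts M) (upTo N)) ⟩
      filterᵇ (lengthAtMost m) (map (map bump) (rowsUpTo (parts M) N))
    ≡⟨ filterᵇ-map (lengthAtMost m) (map bump) (rowsUpTo (parts M) N) ⟩
      map (map bump) (filterᵇ (lengthAtMost m ∘ map bump) (rowsUpTo (parts M) N))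
    ≡⟨ cong (map (map bump)) (filterᵇ-cong (λ r → cong (_≤ᵇ m) (LP.length-map bump r)) (rowsUpTo (parts M) N)) ⟩
      map (map bump) (filterᵇ (lengthAtMost m) (rowsUpTo (parts M) (2 + m)))
    ≡⟨ cong (map (map bump)) (filterᵇ-lengthAtMost-rowsUpTo m (parts M) 2) ⟩
      map (map bump) boundedRows
    ∎ where open ≡-Reasoning

  isDPP-N-rows : ∀ D → All BoundedRow D → length D ≡ N → isDPP M D ≡ false
  isDPP-N-rows D D-ok ℓ≡N with isDPP M D in D∈DPP
  ... | false = refl
  isDPP-N-rows (r ∷ rs) ((_ , ℓ≤m) ∷ _) ℓ≡N | true =
    let (_ , strict , cons) = isDPP⇒rows M (r ∷ rs) D∈DPP
        M≤m = subst (_≤ m) (ℕP.suc-injective ℓ≡N) (ℕP.≤-trans (isDPP⇒rowCount r rs strict cons) ℓ≤m)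
    in ⊥-elim (ℕP.n≮n m M≤m)

  filterᵇ-arraysUpTo-N : filterᵇ (isDPP M) (arraysUpTo (suc N)) ≡ filterᵇ (isDPP M) boundedArrays
  filterᵇ-arraysUpTo-N = begin
      filterᵇ (isDPP M) (arraysUpTo (suc N))
    ≡⟨ cong (filterᵇ (isDPP M)) (trans (cong (concatMap (listsOver boundedRows)) (sym (LP.upTo-∷ʳ N)))
                                       (concatMap-∷ʳ (listsOver boundedRows) (upTo N) N)) ⟩
      filterᵇ (isDPP M) (boundedArrays ++ listsOver boundedRows N)
    ≡⟨ LP.filter-++ (T? ∘ isDPP M) boundedArrays (listsOver boundedRows N) ⟩
      filterᵇ (isDPP M) boundedArrays ++ filterᵇ (isDPP M) (listsOver boundedRows N)
    ≡⟨ cong (filterᵇ (isDPP M) boundedArrays ++_) (filterᵇ-none (All.zipWith (λ {D} (D-ok , ℓ≡N) → isDPP-N-rows D D-ok ℓ≡N)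
                   (listsOver-All boundedRows-bounded N , listsOver-length boundedRows N))) ⟩
      filterᵇ (isDPP M) boundedArrays ++ []
    ≡⟨ LP.++-identityʳ _ ⟩
      filterᵇ (isDPP M) boundedArrays
    ∎ where open ≡-Reasoning

  DPP-ρ₂≡0 : filterᵇ (λ D → ρ₂DPP N D == 0) (DPP N) ≡ map bumpArray (DPP M)
  DPP-ρ₂≡0 = begin
      filterᵇ (λ D → ρ₂DPP N D == 0) (filterᵇ (isDPP N) (candidates N))
    ≡⟨ filterᵇ-filterᵇ-cong (isDPP N) _ (all admissible) ρ₂DPP≡0 (candidates N) ⟩
      filterᵇ (isDPP N) (filterᵇ (all admissible) (candidates N))
    ≡⟨ cong (filterᵇ (isDPP N)) (filterᵇ-concatMap-listsOver id admissible (candidateRows N) (upTo (suc N))) ⟩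
      filterᵇ (isDPP N) (concatMap (listsOver (filterᵇ admissible (candidateRows N))) (upTo (suc N)))
    ≡⟨ cong (λ rows → filterᵇ (isDPP N) (concatMap (listsOver rows) (upTo (suc N)))) candidateRows-admissible ⟩
      filterᵇ (isDPP N) (concatMap (listsOver (map (map bump) boundedRows)) (upTo (suc N)))
    ≡⟨ cong (filterᵇ (isDPP N)) (concatMap-listsOver-map id (map bump) boundedRows (upTo (suc N))) ⟩
      filterᵇ (isDPP N) (map bumpArray arrays)
    ≡⟨ filterᵇ-map (isDPP N) bumpArray arrays ⟩
      map bumpArray (filterᵇ (isDPP N ∘ bumpArray) arrays)
    ≡⟨ cong (map bumpArray) (filterᵇ-cong-local (All.map (isDPP-bump _) (arraysUpTo-bounded (suc N)))) ⟩
      map bumpArray (filterᵇ (isDPP M) arrays)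
    ≡⟨ cong (map bumpArray) (trans filterᵇ-arraysUpTo-N (sym DPP-bounded)) ⟩
      map bumpArray (DPP M)
    ∎ where
      open ≡-Reasoning
      arrays = arraysUpTo (suc N)

  ZDPP-specialise : ∀ x y z → ZDPP M x y z 1ℤ ≡ ZDPP N x y z 0ℤ
  ZDPP-specialise x y z =
    sumℤ-specialise (weight M) (weight N) (ρ₂DPP M) (ρ₂DPP N) bumpArray (DPP M) (DPP N) DPP-ρ₂≡0
      (All.map (λ {D} D-ok → cong₂ ℤ._*_ (cong₂ ℤ._*_ (cong (x ℤ.^_) (νDPP-bump D D-ok))
                                                      (cong (y ℤ.^_) (μDPP-bump D D-ok)))
                                         (cong (z ℤ.^_) (ρ₁DPP-bump D D-ok)))
               DPP-bounded-rows)
    where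
      weight : ℕ → Array → ℤ
      weight n D = x ℤ.^ νDPP D ℤ.* y ℤ.^ μDPP D ℤ.* z ℤ.^ ρ₁DPP n D

IsSign : ℤ → Set
IsSign a = a ≡ 0ℤ ⊎ a ≡ 1ℤ ⊎ a ≡ -1ℤ

IsBit : ℤ → Set
IsBit a = a ≡ 0ℤ ⊎ a ≡ 1ℤ

IsUnit : ℤ → Set
IsUnit a = a ≡ 1ℤ ⊎ a ≡ -1ℤ

nonzeros : List ℤ → List ℤ
nonzeros = filterᵇ (λ a → not (a ==ℤ 0ℤ))

nonzeros-++ : ∀ xs ys → nonzeros (xs ++ ys) ≡ nonzeros xs ++ nonzeros ys
nonzeros-++ = LP.filter-++ (T? ∘ (λ a → not (a ==ℤ 0ℤ)))

nonzeros-units : ∀ xs → All IsSign xs → All IsUnit (nonzeros xs)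
nonzeros-units [] [] = []
nonzeros-units (_ ∷ xs) (inj₁ refl ∷ s) = nonzeros-units xs s
nonzeros-units (_ ∷ xs) (inj₂ (inj₁ refl) ∷ s) = inj₁ refl ∷ nonzeros-units xs s
nonzeros-units (_ ∷ xs) (inj₂ (inj₂ refl) ∷ s) = inj₂ refl ∷ nonzeros-units xs s

goodLine⇒sum≡1 : ∀ xs → goodLine xs ≡ true → sumℤ (nonzeros xs) ≡ 1ℤ
goodLine⇒sum≡1 xs good = ⌊⌋-true⁻ (_ ℤ.≟ 1ℤ) (proj₂ (∧-true⁻ (alternates (nonzeros xs)) good))

goodLine-∷ʳ-0 : ∀ xs → goodLine (xs L.∷ʳ 0ℤ) ≡ goodLine xs
goodLine-∷ʳ-0 xs = cong (λ l → alternates l ∧ (sumℤ l ==ℤ 1ℤ))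
                        (trans (nonzeros-++ xs (0ℤ ∷ [])) (LP.++-identityʳ (nonzeros xs)))

goodLine-zeros-∷ʳ-1 : ∀ k → goodLine (L.replicate k 0ℤ L.∷ʳ 1ℤ) ≡ true
goodLine-zeros-∷ʳ-1 zero = refl
goodLine-zeros-∷ʳ-1 (suc k) = goodLine-zeros-∷ʳ-1 k

lastOr : ℤ → List ℤ → ℤ
lastOr d [] = d
lastOr d (x ∷ xs) = lastOr x xs

lastOr-∷ʳ : ∀ d xs x → lastOr d (xs L.∷ʳ x) ≡ x
lastOr-∷ʳ d [] x = refl
lastOr-∷ʳ d (y ∷ xs) x = lastOr-∷ʳ y xs x

alternating-sum : ∀ a xs → All IsUnit (a ∷ xs) → alternates (a ∷ xs) ≡ true →
                  (sumℤ (a ∷ xs) ≡ 0ℤ × lastOr a xs ≡ ℤ.- a) ⊎ (sumℤ (a ∷ xs) ≡ a × lastOr a xs ≡ a)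
alternating-sum a [] _ _ = inj₂ (ℤP.+-identityʳ a , refl)
alternating-sum a (b ∷ xs) (ua ∷ ub ∷ us) alt =
  let (a≢b , alt′) = ∧-true⁻ (not (a ==ℤ b)) alt
  in step (opposite ua ub (⌊⌋-false⁻ (a ℤ.≟ b) (not-true a≢b))) (alternating-sum b xs (ub ∷ us) alt′)
  where
    not-true : ∀ {x} → not x ≡ true → x ≡ false
    not-true {false} _ = refl
    opposite : ∀ {a b} → IsUnit a → IsUnit b → a ≢ b → b ≡ ℤ.- a
    opposite (inj₁ refl) (inj₁ refl) a≢b = ⊥-elim (a≢b refl)
    opposite (inj₁ refl) (inj₂ refl) _   = refl
    opposite (inj₂ refl) (inj₁ refl) _   = refl
    opposite (inj₂ refl) (inj₂ refl) a≢b = ⊥-elim (a≢b refl)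
    step : b ≡ ℤ.- a →
           (sumℤ (b ∷ xs) ≡ 0ℤ × lastOr b xs ≡ ℤ.- b) ⊎ (sumℤ (b ∷ xs) ≡ b × lastOr b xs ≡ b) →
           (sumℤ (a ∷ b ∷ xs) ≡ 0ℤ × lastOr b xs ≡ ℤ.- a) ⊎ (sumℤ (a ∷ b ∷ xs) ≡ a × lastOr b xs ≡ a)
    step b≡-a (inj₁ (s≡0 , l≡-b)) = inj₂ (trans (cong (ℤ._+_ a) s≡0) (ℤP.+-identityʳ a) ,
                                          trans l≡-b (trans (cong ℤ.-_ b≡-a) (ℤP.neg-involutive a)))
    step b≡-a (inj₂ (s≡b , l≡b)) = inj₁ (trans (cong (ℤ._+_ a) (trans s≡b b≡-a)) (ℤP.+-inverseʳ a) ,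
                                          trans l≡b b≡-a)

-- By alternating-sum, a line summing to 1 starts and ends with the nonzero entry 1.
goodLine-∷ʳ-−1 : ∀ xs → All IsSign xs → goodLine (xs L.∷ʳ -1ℤ) ≡ false
goodLine-∷ʳ-−1 xs s with nonzeros (xs L.∷ʳ -1ℤ) in eq
... | [] with () ← LP.++-conicalʳ (nonzeros xs) (-1ℤ ∷ []) (trans (sym (nonzeros-++ xs (-1ℤ ∷ []))) eq)
... | a ∷ ys with alternates (a ∷ ys) in alt
...   | false = refl
...   | true  = ⌊⌋-false (sumℤ (a ∷ ys) ℤ.≟ 1ℤ) sum≢1
  where
    nz≡ : nonzeros xs L.∷ʳ -1ℤ ≡ a ∷ ys
    nz≡ = trans (sym (nonzeros-++ xs (-1ℤ ∷ []))) eq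
    units : All IsUnit (a ∷ ys)
    units = subst (All IsUnit) nz≡ (AllP.++⁺ (nonzeros-units xs s) (inj₂ refl ∷ []))
    last≡-1 : lastOr a ys ≡ -1ℤ
    last≡-1 = trans (cong (lastOr 0ℤ) (sym nz≡)) (lastOr-∷ʳ 0ℤ (nonzeros xs) -1ℤ)
    sum≢1 : sumℤ (a ∷ ys) ≢ 1ℤ
    sum≢1 s≡1 with alternating-sum a ys units alt
    ... | inj₁ (s≡0 , _) with () ← trans (sym s≡0) s≡1
    ... | inj₂ (s≡a , l≡a) with () ← trans (sym (trans (sym l≡a) last≡-1)) (trans (sym s≡a) s≡1)

bits-sum : ∀ xs → All IsBit xs → All (_≡ 0ℤ) xs ⊎ Σ ℕ (λ n → sumℤ (nonzeros xs) ≡ + suc n)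
bits-sum [] [] = inj₁ []
bits-sum (_ ∷ xs) (inj₁ refl ∷ bs) with bits-sum xs bs
... | inj₁ zs       = inj₁ (refl ∷ zs)
... | inj₂ (n , s)  = inj₂ (n , s)
bits-sum (_ ∷ xs) (inj₂ refl ∷ bs) with bits-sum xs bs
... | inj₁ zs       = inj₂ (0 , cong (ℤ._+_ 1ℤ) (sum-zeros xs zs))
  where
    sum-zeros : ∀ ys → All (_≡ 0ℤ) ys → sumℤ (nonzeros ys) ≡ 0ℤ
    sum-zeros [] [] = refl
    sum-zeros (_ ∷ ys) (refl ∷ zs) = sum-zeros ys zs
... | inj₂ (n , s)  = inj₂ (suc n , cong (ℤ._+_ 1ℤ) s)

goodLine-∷ʳ-1⇒zeros : ∀ xs → All IsBit xs → goodLine (xs L.∷ʳ 1ℤ) ≡ true → All (_≡ 0ℤ) xs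
goodLine-∷ʳ-1⇒zeros xs bs good with bits-sum xs bs
... | inj₁ zs = zs
... | inj₂ (n , s) = ⊥-elim (2+n≢1 sum≡)
  where
    2+n≢1 : + suc (suc n) ≢ 1ℤ
    2+n≢1 ()
    sum≡ : + suc (suc n) ≡ 1ℤ
    sum≡ = begin
        (+ suc (suc n))                         ≡⟨ ℤP.+-comm (+ suc n) 1ℤ ⟨
        (+ suc n) ℤ.+ 1ℤ                        ≡⟨ cong (ℤ._+ 1ℤ) s ⟨
        sumℤ (nonzeros xs) ℤ.+ sumℤ (1ℤ ∷ [])   ≡⟨ sumℤ-++ (nonzeros xs) (1ℤ ∷ []) ⟨
        sumℤ (nonzeros xs L.∷ʳ 1ℤ)             ≡⟨ cong sumℤ (nonzeros-++ xs (1ℤ ∷ [])) ⟨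
        sumℤ (nonzeros (xs L.∷ʳ 1ℤ))           ≡⟨ goodLine⇒sum≡1 (xs L.∷ʳ 1ℤ) good ⟩
        1ℤ                                      ∎
      where open ≡-Reasoning

zerosBeforeOne-∷ʳ-0⊎sum≤0 : ∀ xs → All IsSign xs →
                            zerosBeforeOne (xs L.∷ʳ 0ℤ) ≡ zerosBeforeOne xs ⊎ Σ ℕ (λ n → sumℤ (nonzeros xs) ≡ ℤ.- + n)
zerosBeforeOne-∷ʳ-0⊎sum≤0 [] [] = inj₂ (0 , refl)
zerosBeforeOne-∷ʳ-0⊎sum≤0 (_ ∷ xs) (inj₂ (inj₁ refl) ∷ _) = inj₁ refl
zerosBeforeOne-∷ʳ-0⊎sum≤0 (_ ∷ xs) (inj₁ refl ∷ s) with zerosBeforeOne-∷ʳ-0⊎sum≤0 xs s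
... | inj₁ e   = inj₁ (cong suc e)
... | inj₂ neg = inj₂ neg
zerosBeforeOne-∷ʳ-0⊎sum≤0 (_ ∷ xs) (inj₂ (inj₂ refl) ∷ s) with zerosBeforeOne-∷ʳ-0⊎sum≤0 xs s
... | inj₁ e          = inj₁ e
... | inj₂ (zero , e)  = inj₂ (1 , cong (ℤ._+_ -1ℤ) e)
... | inj₂ (suc n , e) = inj₂ (suc (suc n) , cong (ℤ._+_ -1ℤ) e)

zerosBeforeOne-∷ʳ-0 : ∀ xs → All IsSign xs → goodLine xs ≡ true → zerosBeforeOne (xs L.∷ʳ 0ℤ) ≡ zerosBeforeOne xs
zerosBeforeOne-∷ʳ-0 xs s good with zerosBeforeOne-∷ʳ-0⊎sum≤0 xs s
... | inj₁ e = e
... | inj₂ (n , e) = ⊥-elim (-n≢1 n (trans (sym e) (goodLine⇒sum≡1 xs good)))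
  where
    -n≢1 : ∀ n → ℤ.- + n ≢ 1ℤ
    -n≢1 zero ()
    -n≢1 (suc n) ()

-- Alternating sign matrices with ρ₂ = 0

module _ {A : Set} where

  transpose-∷ : ∀ {m n} (as : Vec A n) (ass : Vec (Vec A n) m) →
                V.transpose (as V.∷ ass) ≡ V.zipWith V._∷_ as (V.transpose ass)
  transpose-∷ as ass = sym (VP.zipWith-is-⊛ V._∷_ as (V.transpose ass))

  transpose-∷ʳ : ∀ {m n} (ass : Vec (Vec A n) m) (as : Vec A n) →
                 V.transpose (ass ∷ʳ as) ≡ V.zipWith _∷ʳ_ (V.transpose ass) as
  transpose-∷ʳ V.[] as = trans (transpose-∷ as V.[]) (base as)
    where
      base : ∀ {n} (as : Vec A n) → V.zipWith V._∷_ as (V.replicate n V.[]) ≡ V.zipWith _∷ʳ_ (V.replicate n V.[]) as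
      base V.[] = refl
      base (x V.∷ as) = cong (_ V.∷_) (base as)
  transpose-∷ʳ (bs V.∷ ass) as = begin
      V.transpose (bs V.∷ (ass ∷ʳ as))
    ≡⟨ transpose-∷ bs (ass ∷ʳ as) ⟩
      V.zipWith V._∷_ bs (V.transpose (ass ∷ʳ as))
    ≡⟨ cong (V.zipWith V._∷_ bs) (transpose-∷ʳ ass as) ⟩
      V.zipWith V._∷_ bs (V.zipWith _∷ʳ_ (V.transpose ass) as)
    ≡⟨ ∷-∷ʳ bs (V.transpose ass) as ⟩
      V.zipWith _∷ʳ_ (V.zipWith V._∷_ bs (V.transpose ass)) as
    ≡⟨ cong (λ t → V.zipWith _∷ʳ_ t as) (transpose-∷ bs ass) ⟨
      V.zipWith _∷ʳ_ (V.transpose (bs V.∷ ass)) as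
    ∎ where
      open ≡-Reasoning
      ∷-∷ʳ : ∀ {m n} (v : Vec A n) (T : Vec (Vec A m) n) r →
             V.zipWith V._∷_ v (V.zipWith _∷ʳ_ T r) ≡ V.zipWith _∷ʳ_ (V.zipWith V._∷_ v T) r
      ∷-∷ʳ V.[] V.[] V.[] = refl
      ∷-∷ʳ (x V.∷ v) (t V.∷ T) (y V.∷ r) = cong (_ V.∷_) (∷-∷ʳ v T r)

  replicate-∷ʳ : ∀ n (x : A) → V.replicate (suc n) x ≡ V.replicate n x ∷ʳ x
  replicate-∷ʳ zero x = refl
  replicate-∷ʳ (suc n) x = cong (x V.∷_) (replicate-∷ʳ n x)

zipWith-∷ʳ : ∀ {A B C : Set} (f : A → B → C) {n} (xs : Vec A n) ys x y →
             V.zipWith f (xs ∷ʳ x) (ys ∷ʳ y) ≡ V.zipWith f xs ys ∷ʳ f x y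
zipWith-∷ʳ f V.[] V.[] x y = refl
zipWith-∷ʳ f (a V.∷ xs) (b V.∷ ys) x y = cong (f a b V.∷_) (zipWith-∷ʳ f xs ys x y)

transpose-zipWith-∷ʳ : ∀ {A : Set} {m n} (ass : Vec (Vec A n) m) (c : Vec A m) →
                       V.transpose (V.zipWith _∷ʳ_ ass c) ≡ V.transpose ass ∷ʳ c
transpose-zipWith-∷ʳ {n = n} V.[] V.[] = replicate-∷ʳ n V.[]
transpose-zipWith-∷ʳ (as V.∷ ass) (x V.∷ c) = begin
    V.transpose ((as ∷ʳ x) V.∷ V.zipWith _∷ʳ_ ass c)
  ≡⟨ transpose-∷ (as ∷ʳ x) (V.zipWith _∷ʳ_ ass c) ⟩
    V.zipWith V._∷_ (as ∷ʳ x) (V.transpose (V.zipWith _∷ʳ_ ass c))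
  ≡⟨ cong (V.zipWith V._∷_ (as ∷ʳ x)) (transpose-zipWith-∷ʳ ass c) ⟩
    V.zipWith V._∷_ (as ∷ʳ x) (V.transpose ass ∷ʳ c)
  ≡⟨ zipWith-∷ʳ V._∷_ as (V.transpose ass) x c ⟩
    V.zipWith V._∷_ as (V.transpose ass) ∷ʳ (x V.∷ c)
  ≡⟨ cong (_∷ʳ (x V.∷ c)) (transpose-∷ as ass) ⟨
    V.transpose (as V.∷ ass) ∷ʳ (x V.∷ c)
  ∎ where open ≡-Reasoning

All-transpose : ∀ {A : Set} {P : A → Set} {m n} (ass : Vec (Vec A n) m) →
                All (All P ∘ V.toList) (V.toList ass) → All (All P ∘ V.toList) (V.toList (V.transpose ass))
All-transpose {P = P} {n = n} V.[] _ = empties n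
  where
    empties : ∀ n → All (All P ∘ V.toList) (V.toList (V.replicate n V.[]))
    empties zero = []
    empties (suc n) = [] ∷ empties n
All-transpose {P = P} (as V.∷ ass) (pas ∷ pass) =
  subst (All (All P ∘ V.toList) ∘ V.toList) (sym (transpose-∷ as ass))
        (zip-∷ as (V.transpose ass) pas (All-transpose ass pass))
  where
    zip-∷ : ∀ {m n} (w : Vec _ n) (T : Vec (Vec _ m) n) → All P (V.toList w) → All (All P ∘ V.toList) (V.toList T) →
            All (All P ∘ V.toList) (V.toList (V.zipWith V._∷_ w T))
    zip-∷ V.[] V.[] _ _ = []
    zip-∷ (x V.∷ w) (t V.∷ T) (px ∷ pw) (pt ∷ pT) = (px ∷ pt) ∷ zip-∷ w T pw pT

rowsGood : ∀ {m n} → Vec (Vec ℤ n) m → Bool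
rowsGood A = all (goodLine ∘ V.toList) (V.toList A)

rowsGood-∷ʳ : ∀ {m n} (A : Vec (Vec ℤ n) m) r → rowsGood (A ∷ʳ r) ≡ rowsGood A ∧ goodLine (V.toList r)
rowsGood-∷ʳ A r = trans (cong (all (goodLine ∘ V.toList)) (VP.toList-∷ʳ r A))
  (trans (all-++ (goodLine ∘ V.toList) (V.toList A) (r ∷ [])) (cong (rowsGood A ∧_) (∧-identityʳ _)))

zeros : ∀ n → Vec ℤ n
zeros n = V.replicate n 0ℤ

allZero : ∀ {n} → Vec ℤ n → Bool
allZero v = all (_==ℤ 0ℤ) (V.toList v)

All-zero⇒zeros : ∀ {n} (v : Vec ℤ n) → All (_≡ 0ℤ) (V.toList v) → v ≡ zeros n
All-zero⇒zeros V.[] _ = refl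
All-zero⇒zeros (x V.∷ v) (refl ∷ zs) = cong (0ℤ V.∷_) (All-zero⇒zeros v zs)

allZero⇒zeros : ∀ {n} (v : Vec ℤ n) → allZero v ≡ true → v ≡ zeros n
allZero⇒zeros v e = All-zero⇒zeros v (All.map (⌊⌋-true⁻ (_ ℤ.≟ 0ℤ)) (all⇒All _ (V.toList v) e))

allZero-zeros : ∀ n → allZero (zeros n) ≡ true
allZero-zeros zero = refl
allZero-zeros (suc n) = allZero-zeros n

goodLine-zeros-1 : ∀ k → goodLine (V.toList (zeros k ∷ʳ 1ℤ)) ≡ true
goodLine-zeros-1 k = trans (cong goodLine (trans (VP.toList-∷ʳ 1ℤ (zeros k)) (cong (_++ 1ℤ ∷ []) (VP.toList-replicate k 0ℤ))))
                           (goodLine-zeros-∷ʳ-1 k)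

rowsGood-∷ʳ-zeros : ∀ {m n} (A : Vec (Vec ℤ n) m) → rowsGood (V.zipWith _∷ʳ_ A (zeros m)) ≡ rowsGood A
rowsGood-∷ʳ-zeros V.[] = refl
rowsGood-∷ʳ-zeros (r V.∷ A) =
  cong₂ _∧_ (trans (cong goodLine (VP.toList-∷ʳ 0ℤ r)) (goodLine-∷ʳ-0 (V.toList r))) (rowsGood-∷ʳ-zeros A)

SignRows : ∀ {m n} → Vec (Vec ℤ n) m → Set
SignRows A = All (All IsSign ∘ V.toList) (V.toList A)

rowsGood-∷ʳ⇒bits : ∀ {m n} (A : Vec (Vec ℤ n) m) (c : Vec ℤ m) → SignRows A → All IsSign (V.toList c) →
                   rowsGood (V.zipWith _∷ʳ_ A c) ≡ true → All IsBit (V.toList c)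
rowsGood-∷ʳ⇒bits V.[] V.[] _ _ _ = []
rowsGood-∷ʳ⇒bits (r V.∷ A) (x V.∷ c) (sr ∷ sA) (sx ∷ sc) good =
  let (good-r , good-A) = ∧-true⁻ (goodLine (V.toList (r ∷ʳ x))) good
  in bit sx good-r ∷ rowsGood-∷ʳ⇒bits A c sA sc good-A
  where
    bit : IsSign x → goodLine (V.toList (r ∷ʳ x)) ≡ true → IsBit x
    bit (inj₁ x≡0) _ = inj₁ x≡0
    bit (inj₂ (inj₁ x≡1)) _ = inj₂ x≡1
    bit (inj₂ (inj₂ refl)) good-r
      with () ← trans (sym good-r) (trans (cong goodLine (VP.toList-∷ʳ -1ℤ r)) (goodLine-∷ʳ-−1 (V.toList r) sr))

border : ∀ {k} → Matrix k → Vec ℤ k → Vec ℤ k → ℤ → Matrix (suc k)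
border W c r a = V.zipWith _∷ʳ_ W c ∷ʳ (r ∷ʳ a)

isASM-border : ∀ {k} (W : Matrix k) c r a →
  isASM (border W c r a) ≡ (rowsGood (V.zipWith _∷ʳ_ W c) ∧ goodLine (V.toList (r ∷ʳ a)))
                         ∧ (rowsGood (V.zipWith _∷ʳ_ (V.transpose W) r) ∧ goodLine (V.toList (c ∷ʳ a)))
isASM-border W c r a = cong₂ _∧_ (rowsGood-∷ʳ (V.zipWith _∷ʳ_ W c) (r ∷ʳ a)) (begin
    rowsGood (V.transpose (V.zipWith _∷ʳ_ W c ∷ʳ (r ∷ʳ a)))
  ≡⟨ cong rowsGood (transpose-∷ʳ (V.zipWith _∷ʳ_ W c) (r ∷ʳ a)) ⟩
    rowsGood (V.zipWith _∷ʳ_ (V.transpose (V.zipWith _∷ʳ_ W c)) (r ∷ʳ a))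
  ≡⟨ cong (λ T → rowsGood (V.zipWith _∷ʳ_ T (r ∷ʳ a))) (transpose-zipWith-∷ʳ W c) ⟩
    rowsGood (V.zipWith _∷ʳ_ (V.transpose W ∷ʳ c) (r ∷ʳ a))
  ≡⟨ cong rowsGood (zipWith-∷ʳ _∷ʳ_ (V.transpose W) r c a) ⟩
    rowsGood (V.zipWith _∷ʳ_ (V.transpose W) r ∷ʳ (c ∷ʳ a))
  ≡⟨ rowsGood-∷ʳ (V.zipWith _∷ʳ_ (V.transpose W) r) (c ∷ʳ a) ⟩
    rowsGood (V.zipWith _∷ʳ_ (V.transpose W) r) ∧ goodLine (V.toList (c ∷ʳ a))
  ∎)
  where open ≡-Reasoning

ρ₂ASM-border : ∀ {k} (W : Matrix k) c r a → ρ₂ASM (border W c r a) ≡ zerosBeforeOne (a ∷ L.reverse (V.toList r))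
ρ₂ASM-border W c r a = cong zerosBeforeOne (begin
    L.reverse (V.toList (V.last (V.zipWith _∷ʳ_ W c ∷ʳ (r ∷ʳ a))))
  ≡⟨ cong (L.reverse ∘ V.toList) (VP.last-∷ʳ (r ∷ʳ a) (V.zipWith _∷ʳ_ W c)) ⟩
    L.reverse (V.toList (r ∷ʳ a))
  ≡⟨ cong L.reverse (VP.toList-∷ʳ a r) ⟩
    L.reverse (V.toList r L.∷ʳ a)
  ≡⟨ LP.reverse-++ (V.toList r) (a ∷ []) ⟩
    a ∷ L.reverse (V.toList r)
  ∎)
  where open ≡-Reasoning

isASM∧ρ₂≡0 : ∀ {n} → Matrix n → Bool
isASM∧ρ₂≡0 A = isASM A ∧ (ρ₂ASM A == 0)

isASM∧ρ₂≡0-border-zeros : ∀ {k} (W : Matrix k) → isASM∧ρ₂≡0 (border W (zeros k) (zeros k) 1ℤ) ≡ isASM W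
isASM∧ρ₂≡0-border-zeros {k} W = begin
    isASM (border W (zeros k) (zeros k) 1ℤ) ∧ (ρ₂ASM (border W (zeros k) (zeros k) 1ℤ) == 0)
  ≡⟨ cong₂ _∧_ (isASM-border W (zeros k) (zeros k) 1ℤ) (cong (_== 0) (ρ₂ASM-border W (zeros k) (zeros k) 1ℤ)) ⟩
    ((rowsGood (V.zipWith _∷ʳ_ W (zeros k)) ∧ goodLine (V.toList (zeros k ∷ʳ 1ℤ)))
      ∧ (rowsGood (V.zipWith _∷ʳ_ (V.transpose W) (zeros k)) ∧ goodLine (V.toList (zeros k ∷ʳ 1ℤ)))) ∧ true
  ≡⟨ ∧-identityʳ _ ⟩
    (rowsGood (V.zipWith _∷ʳ_ W (zeros k)) ∧ goodLine (V.toList (zeros k ∷ʳ 1ℤ)))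
      ∧ (rowsGood (V.zipWith _∷ʳ_ (V.transpose W) (zeros k)) ∧ goodLine (V.toList (zeros k ∷ʳ 1ℤ)))
  ≡⟨ cong₂ _∧_ (cong₂ _∧_ (rowsGood-∷ʳ-zeros W) (goodLine-zeros-1 k))
               (cong₂ _∧_ (rowsGood-∷ʳ-zeros (V.transpose W)) (goodLine-zeros-1 k)) ⟩
    (rowsGood W ∧ true) ∧ (rowsGood (V.transpose W) ∧ true)
  ≡⟨ cong₂ _∧_ (∧-identityʳ (rowsGood W)) (∧-identityʳ (rowsGood (V.transpose W))) ⟩
    isASM W
  ∎ where open ≡-Reasoning

-- ρ₂ = 0 puts a 1 in the corner, since a -1 cannot end a good column.  The rest of the last row
-- and column consists of 0s and 1s (rowsGood-∷ʳ⇒bits), so it vanishes.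
isASM∧ρ₂≡0-border⇒ : ∀ {k} (W : Matrix k) c r a → SignRows W → All IsSign (V.toList c) → All IsSign (V.toList r) →
                     IsSign a → isASM∧ρ₂≡0 (border W c r a) ≡ true → r ≡ zeros k × c ≡ zeros k × a ≡ 1ℤ
isASM∧ρ₂≡0-border⇒ {k} W c r a sW sc sr sa good =
  let (asm , ρ₂≡0) = ∧-true⁻ (isASM (border W c r a)) good
      (rows , cols) = ∧-true⁻ _ (trans (sym (isASM-border W c r a)) asm)
      (rows-W , row-r) = ∧-true⁻ (rowsGood (V.zipWith _∷ʳ_ W c)) rows
      (cols-W , col-c) = ∧-true⁻ (rowsGood (V.zipWith _∷ʳ_ (V.transpose W) r)) cols
  in corner sa rows-W row-r cols-W col-c (trans (cong (_== 0) (sym (ρ₂ASM-border W c r a))) ρ₂≡0)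
  where
    zero-line : ∀ (v : Vec ℤ k) → All IsBit (V.toList v) → goodLine (V.toList (v ∷ʳ 1ℤ)) ≡ true → v ≡ zeros k
    zero-line v bits good = All-zero⇒zeros v
      (goodLine-∷ʳ-1⇒zeros (V.toList v) bits (trans (cong goodLine (sym (VP.toList-∷ʳ 1ℤ v))) good))
    corner : IsSign a → rowsGood (V.zipWith _∷ʳ_ W c) ≡ true → goodLine (V.toList (r ∷ʳ a)) ≡ true →
             rowsGood (V.zipWith _∷ʳ_ (V.transpose W) r) ≡ true → goodLine (V.toList (c ∷ʳ a)) ≡ true →
             (zerosBeforeOne (a ∷ L.reverse (V.toList r)) == 0) ≡ true → r ≡ zeros k × c ≡ zeros k × a ≡ 1ℤ
    corner (inj₁ refl) _ _ _ _ ()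
    corner (inj₂ (inj₂ refl)) _ _ _ col-c _
      with () ← trans (sym col-c) (trans (cong goodLine (VP.toList-∷ʳ -1ℤ c)) (goodLine-∷ʳ-−1 (V.toList c) sc))
    corner (inj₂ (inj₁ refl)) rows-W row-r cols-W col-c _ =
      zero-line r (rowsGood-∷ʳ⇒bits (V.transpose W) r (All-transpose W sW) sr cols-W) row-r ,
      zero-line c (rowsGood-∷ʳ⇒bits W c sW sc rows-W) col-c ,
      refl

isASM∧ρ₂≡0-border : ∀ {k} (W : Matrix k) c r a → SignRows W → All IsSign (V.toList c) → All IsSign (V.toList r) →
                    IsSign a → isASM∧ρ₂≡0 (border W c r a) ≡ (allZero r ∧ (a ==ℤ 1ℤ)) ∧ (allZero c ∧ isASM W)
isASM∧ρ₂≡0-border {k} W c r a sW sc sr sa = Bool-ext ⇒ ⇐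
  where
    ⇒ : isASM∧ρ₂≡0 (border W c r a) ≡ true → (allZero r ∧ (a ==ℤ 1ℤ)) ∧ (allZero c ∧ isASM W) ≡ true
    ⇒ good with isASM∧ρ₂≡0-border⇒ W c r a sW sc sr sa good
    ... | refl , refl , refl rewrite allZero-zeros k = trans (sym (isASM∧ρ₂≡0-border-zeros W)) good
    ⇐ : (allZero r ∧ (a ==ℤ 1ℤ)) ∧ (allZero c ∧ isASM W) ≡ true → isASM∧ρ₂≡0 (border W c r a) ≡ true
    ⇐ conds =
      let (r-a , c-W) = ∧-true⁻ (allZero r ∧ (a ==ℤ 1ℤ)) conds
          (r≡0 , a≡1) = ∧-true⁻ (allZero r) r-a
          (c≡0 , W-asm) = ∧-true⁻ (allZero c) c-W
      in zero-border (allZero⇒zeros r r≡0) (allZero⇒zeros c c≡0) (⌊⌋-true⁻ (a ℤ.≟ 1ℤ) a≡1) W-asm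
      where
        zero-border : r ≡ zeros k → c ≡ zeros k → a ≡ 1ℤ → isASM W ≡ true → isASM∧ρ₂≡0 (border W c r a) ≡ true
        zero-border refl refl refl W-asm = trans (isASM∧ρ₂≡0-border-zeros W) W-asm

signs-IsSign : All IsSign signs
signs-IsSign = inj₁ refl ∷ inj₂ (inj₁ refl) ∷ inj₂ (inj₂ refl) ∷ []

split-lastColumn : ∀ {A : Set} {m n} (rows : Vec (Vec A (suc n)) m) →
                   rows ≡ V.zipWith _∷ʳ_ (V.map V.init rows) (V.map V.last rows)
split-lastColumn V.[] = refl
split-lastColumn (row V.∷ rows) = cong₂ V._∷_ (proj₂ (proj₂ (V.initLast row))) (split-lastColumn rows)

IsSign-init-last : ∀ {n} (row : Vec ℤ (suc n)) → All IsSign (V.toList row) →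
                   All IsSign (V.toList (V.init row)) × IsSign (V.last row)
IsSign-init-last row s with AllP.++⁻ (V.toList (V.init row))
  (subst (All IsSign) (VP.toList-∷ʳ (V.last row) (V.init row)) (subst (All IsSign ∘ V.toList) (proj₂ (proj₂ (V.initLast row))) s))
... | s-init , (s-last ∷ []) = s-init , s-last

allZero-map : ∀ {A : Set} (f : A → ℤ) {n} (xs : Vec A n) → allZero (V.map f xs) ≡ all ((_==ℤ 0ℤ) ∘ f) (V.toList xs)
allZero-map f V.[] = refl
allZero-map f (x V.∷ xs) = cong ((f x ==ℤ 0ℤ) ∧_) (allZero-map f xs)

module Extension (k : ℕ) where

  signRows : List (Vec ℤ (suc k))
  signRows = vecsOver signs (suc k)

  lastRow : Vec ℤ (suc k)
  lastRow = zeros k ∷ʳ 1ℤ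

  extend : Matrix k → Matrix (suc k)
  extend B = V.map (_∷ʳ 0ℤ) B ∷ʳ lastRow

  zeroColumn∧ASM : Vec (Vec ℤ (suc k)) k → Bool
  zeroColumn∧ASM rows = allZero (V.map V.last rows) ∧ isASM (V.map V.init rows)

  isASM∧ρ₂≡0-∷ʳ : ∀ rows → SignRows rows → ∀ v a → All IsSign (V.toList v) → IsSign a →
                  isASM∧ρ₂≡0 (rows ∷ʳ (v ∷ʳ a)) ≡ (allZero v ∧ (a ==ℤ 1ℤ)) ∧ zeroColumn∧ASM rows
  isASM∧ρ₂≡0-∷ʳ rows s v a sv sa =
    trans (cong (λ t → isASM∧ρ₂≡0 (t ∷ʳ (v ∷ʳ a))) (split-lastColumn rows))
          (isASM∧ρ₂≡0-border (V.map V.init rows) (V.map V.last rows) v a s-init s-last sv sa)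
    where
      s-init : SignRows (V.map V.init rows)
      s-init = subst (All (All IsSign ∘ V.toList)) (sym (VP.toList-map V.init rows))
                     (AllP.map⁺ (All.map (proj₁ ∘ IsSign-init-last _) s))
      s-last : All IsSign (V.toList (V.map V.last rows))
      s-last = subst (All IsSign) (sym (VP.toList-map V.last rows))
                     (AllP.map⁺ (All.map (proj₂ ∘ IsSign-init-last _) s))

  lastRows : ∀ rows → SignRows rows →
             filterᵇ (λ r → isASM∧ρ₂≡0 (rows ∷ʳ r)) signRows ≡ (if zeroColumn∧ASM rows then lastRow ∷ [] else [])
  lastRows rows s = begin
      filterᵇ P signRows
    ≡⟨ cong (filterᵇ P) (vecsOver-∷ʳ signs k) ⟩
      filterᵇ P (concatMap (λ v → map (v ∷ʳ_) signs) (vecsOver signs k))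
    ≡⟨ filterᵇ-concatMap P (λ v → map (v ∷ʳ_) signs) (vecsOver signs k) ⟩
      concatMap (λ v → filterᵇ P (map (v ∷ʳ_) signs)) (vecsOver signs k)
    ≡⟨ concatMap-cong-local (All.map (λ {v} sv → trans (filterᵇ-map P (v ∷ʳ_) signs)
         (cong (map (v ∷ʳ_)) (trans (filterᵇ-cong-local (All.map (isASM∧ρ₂≡0-∷ʳ rows s v _ sv) signs-IsSign))
                                    (corners (allZero v) (zeroColumn∧ASM rows)))))
         (vecsOver-All signs-IsSign k)) ⟩
      concatMap (λ v → map (v ∷ʳ_) (if allZero v ∧ zeroColumn∧ASM rows then 1ℤ ∷ [] else [])) (vecsOver signs k)
    ≡⟨ only-zeros (zeroColumn∧ASM rows) ⟩
      (if zeroColumn∧ASM rows then lastRow ∷ [] else [])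
    ∎ where
      open ≡-Reasoning
      P : Vec ℤ (suc k) → Bool
      P r = isASM∧ρ₂≡0 (rows ∷ʳ r)
      corners : ∀ b b′ → filterᵇ (λ a → (b ∧ (a ==ℤ 1ℤ)) ∧ b′) signs ≡ (if b ∧ b′ then 1ℤ ∷ [] else [])
      corners true  true  = refl
      corners true  false = refl
      corners false _     = refl
      zero-vectors : ∀ b → filterᵇ (λ v → allZero v ∧ b) (vecsOver signs k) ≡ (if b then zeros k ∷ [] else [])
      zero-vectors true = trans (filterᵇ-cong (∧-identityʳ ∘ allZero) (vecsOver signs k))
                                (trans (filterᵇ-vecsOver (_==ℤ 0ℤ) signs k) (vecsOver-[ 0ℤ ] k))
      zero-vectors false = filterᵇ-none {xs = vecsOver signs k} (All.tabulate (λ {v} _ → ∧-zeroʳ (allZero v)))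
      only-zeros : ∀ b → concatMap (λ v → map (v ∷ʳ_) (if allZero v ∧ b then 1ℤ ∷ [] else [])) (vecsOver signs k)
                         ≡ (if b then lastRow ∷ [] else [])
      only-zeros b = begin
          concatMap (λ v → map (v ∷ʳ_) (if allZero v ∧ b then 1ℤ ∷ [] else [])) (vecsOver signs k)
        ≡⟨ LP.concatMap-cong (λ v → map-if (allZero v ∧ b) (v ∷ʳ_)) (vecsOver signs k) ⟩
          concatMap (λ v → if allZero v ∧ b then (v ∷ʳ 1ℤ) ∷ [] else []) (vecsOver signs k)
        ≡⟨ concatMap-if (λ v → allZero v ∧ b) (_∷ʳ 1ℤ) (vecsOver signs k) ⟩
          map (_∷ʳ 1ℤ) (filterᵇ (λ v → allZero v ∧ b) (vecsOver signs k))
        ≡⟨ cong (map (_∷ʳ 1ℤ)) (zero-vectors b) ⟩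
          map (_∷ʳ 1ℤ) (if b then zeros k ∷ [] else [])
        ≡⟨ map-if b (_∷ʳ 1ℤ) ⟩
          (if b then lastRow ∷ [] else [])
        ∎

  lastEntryZero : Vec ℤ (suc k) → Bool
  lastEntryZero row = V.last row ==ℤ 0ℤ

  signRows-lastEntryZero : filterᵇ lastEntryZero signRows ≡ map (_∷ʳ 0ℤ) (vecsOver signs k)
  signRows-lastEntryZero = begin
      filterᵇ lastEntryZero signRows
    ≡⟨ cong (filterᵇ lastEntryZero) (vecsOver-∷ʳ signs k) ⟩
      filterᵇ lastEntryZero (concatMap (λ v → map (v ∷ʳ_) signs) (vecsOver signs k))
    ≡⟨ filterᵇ-concatMap lastEntryZero (λ v → map (v ∷ʳ_) signs) (vecsOver signs k) ⟩
      concatMap (λ v → filterᵇ lastEntryZero (map (v ∷ʳ_) signs)) (vecsOver signs k)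
    ≡⟨ LP.concatMap-cong (λ v → trans (filterᵇ-map lastEntryZero (v ∷ʳ_) signs)
         (cong (map (v ∷ʳ_)) (filterᵇ-cong (λ a → cong (_==ℤ 0ℤ) (VP.last-∷ʳ a v)) signs))) (vecsOver signs k) ⟩
      concatMap (λ v → (v ∷ʳ 0ℤ) ∷ []) (vecsOver signs k)
    ≡⟨ concatMap-[ _∷ʳ 0ℤ ] (vecsOver signs k) ⟩
      map (_∷ʳ 0ℤ) (vecsOver signs k)
    ∎ where open ≡-Reasoning

  zeroColumn∧ASM-rows : filterᵇ zeroColumn∧ASM (vecsOver signRows k) ≡ map (V.map (_∷ʳ 0ℤ)) (ASM k)
  zeroColumn∧ASM-rows = begin
      filterᵇ zeroColumn∧ASM (vecsOver signRows k)
    ≡⟨ filterᵇ-cong (λ rows → cong (_∧ isASM (V.map V.init rows)) (allZero-map V.last rows)) (vecsOver signRows k) ⟩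
      filterᵇ (λ rows → all lastEntryZero (V.toList rows) ∧ isASM (V.map V.init rows)) (vecsOver signRows k)
    ≡⟨ filterᵇ-filterᵇ (isASM ∘ V.map V.init) (all lastEntryZero ∘ V.toList) (vecsOver signRows k) ⟨
      filterᵇ (isASM ∘ V.map V.init) (filterᵇ (all lastEntryZero ∘ V.toList) (vecsOver signRows k))
    ≡⟨ cong (filterᵇ (isASM ∘ V.map V.init)) (begin
           filterᵇ (all lastEntryZero ∘ V.toList) (vecsOver signRows k)
         ≡⟨ filterᵇ-vecsOver lastEntryZero signRows k ⟩
           vecsOver (filterᵇ lastEntryZero signRows) k
         ≡⟨ cong (λ rows → vecsOver rows k) signRows-lastEntryZero ⟩
           vecsOver (map (_∷ʳ 0ℤ) (vecsOver signs k)) k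
         ≡⟨ vecsOver-map (_∷ʳ 0ℤ) (vecsOver signs k) k ⟩
           map (V.map (_∷ʳ 0ℤ)) (allSignMatrices k)
         ∎) ⟩
      filterᵇ (isASM ∘ V.map V.init) (map (V.map (_∷ʳ 0ℤ)) (allSignMatrices k))
    ≡⟨ filterᵇ-map (isASM ∘ V.map V.init) (V.map (_∷ʳ 0ℤ)) (allSignMatrices k) ⟩
      map (V.map (_∷ʳ 0ℤ)) (filterᵇ (isASM ∘ V.map V.init ∘ V.map (_∷ʳ 0ℤ)) (allSignMatrices k))
    ≡⟨ cong (map (V.map (_∷ʳ 0ℤ))) (filterᵇ-cong (λ B → cong isASM (init-∷ʳ-0 B)) (allSignMatrices k)) ⟩
      map (V.map (_∷ʳ 0ℤ)) (ASM k)
    ∎ where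
      open ≡-Reasoning
      init-∷ʳ-0 : ∀ {m} (B : Vec (Vec ℤ k) m) → V.map V.init (V.map (_∷ʳ 0ℤ) B) ≡ B
      init-∷ʳ-0 V.[] = refl
      init-∷ʳ-0 (b V.∷ B) = cong₂ V._∷_ (VP.init-∷ʳ 0ℤ b) (init-∷ʳ-0 B)

  ASM-ρ₂≡0 : filterᵇ isASM∧ρ₂≡0 (allSignMatrices (suc k)) ≡ map extend (ASM k)
  ASM-ρ₂≡0 = begin
      filterᵇ isASM∧ρ₂≡0 (vecsOver signRows (suc k))
    ≡⟨ cong (filterᵇ isASM∧ρ₂≡0) (vecsOver-∷ʳ signRows k) ⟩
      filterᵇ isASM∧ρ₂≡0 (concatMap (λ rows → map (rows ∷ʳ_) signRows) (vecsOver signRows k))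
    ≡⟨ filterᵇ-concatMap isASM∧ρ₂≡0 (λ rows → map (rows ∷ʳ_) signRows) (vecsOver signRows k) ⟩
      concatMap (λ rows → filterᵇ isASM∧ρ₂≡0 (map (rows ∷ʳ_) signRows)) (vecsOver signRows k)
    ≡⟨ concatMap-cong-local (All.map (λ {rows} s →
         trans (filterᵇ-map isASM∧ρ₂≡0 (rows ∷ʳ_) signRows)
               (trans (cong (map (rows ∷ʳ_)) (lastRows rows s)) (map-if (zeroColumn∧ASM rows) (rows ∷ʳ_))))
         (vecsOver-All (vecsOver-All signs-IsSign (suc k)) k)) ⟩
      concatMap (λ rows → if zeroColumn∧ASM rows then (rows ∷ʳ lastRow) ∷ [] else []) (vecsOver signRows k)
    ≡⟨ concatMap-if zeroColumn∧ASM (_∷ʳ lastRow) (vecsOver signRows k) ⟩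
      map (_∷ʳ lastRow) (filterᵇ zeroColumn∧ASM (vecsOver signRows k))
    ≡⟨ cong (map (_∷ʳ lastRow)) zeroColumn∧ASM-rows ⟩
      map (_∷ʳ lastRow) (map (V.map (_∷ʳ 0ℤ)) (ASM k))
    ≡⟨ LP.map-∘ (ASM k) ⟨
      map extend (ASM k)
    ∎ where open ≡-Reasoning

-- The statistics of B ⊕ (1)

sumℤ-concatMap-tabulate : ∀ {A : Set} {n} (f : A → List ℤ) (g : Fin n → A) →
                          sumℤ (concatMap f (tabulate g)) ≡ ∑ (sumℤ ∘ f ∘ g)
sumℤ-concatMap-tabulate {n = zero} f g = refl
sumℤ-concatMap-tabulate {n = suc n} f g =
  trans (sumℤ-++ (f (g Fin.zero)) _) (cong (ℤ._+_ (sumℤ (f (g Fin.zero)))) (sumℤ-concatMap-tabulate f (g ∘ Fin.suc)))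

∑-zero : ∀ {n} {f : Fin n → ℤ} → (∀ i → f i ≡ 0ℤ) → ∑ f ≡ 0ℤ
∑-zero {n} f≡0 = trans (sum-cong-≗ f≡0) (sum-replicate-zero n)

∑-last-zero : ∀ {n} (f : Fin (suc n) → ℤ) → f (fromℕ n) ≡ 0ℤ → ∑ f ≡ ∑ (f ∘ inject₁)
∑-last-zero f last≡0 = trans (sum-init-last f) (trans (cong (ℤ._+_ (∑ (f ∘ inject₁))) last≡0) (ℤP.+-identityʳ _))

data LastView : ∀ {n} → Fin (suc n) → Set where
  inner : ∀ {n} (i : Fin n) → LastView (inject₁ i)
  last  : ∀ {n} → LastView (fromℕ n)

lastView : ∀ {n} (i : Fin (suc n)) → LastView i
lastView {zero} Fin.zero = last
lastView {suc n} Fin.zero = inner Fin.zero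
lastView {suc n} (Fin.suc i) with lastView i
... | inner j = inner (Fin.suc j)
... | last = last

lookup-∷ʳ-inject₁ : ∀ {A : Set} {n} (xs : Vec A n) x i → V.lookup (xs ∷ʳ x) (inject₁ i) ≡ V.lookup xs i
lookup-∷ʳ-inject₁ (y V.∷ xs) x Fin.zero = refl
lookup-∷ʳ-inject₁ (y V.∷ xs) x (Fin.suc i) = lookup-∷ʳ-inject₁ xs x i

lookup-∷ʳ-last : ∀ {A : Set} {n} (xs : Vec A n) x → V.lookup (xs ∷ʳ x) (fromℕ n) ≡ x
lookup-∷ʳ-last V.[] x = refl
lookup-∷ʳ-last (y V.∷ xs) x = lookup-∷ʳ-last xs x

νcell : ∀ {n} → Matrix n → Fin n → Fin n → Fin n → Fin n → List ℤ
νcell A i i′ j j′ = if (toℕ i <ᵇ toℕ i′) ∧ (toℕ j′ ≤ᵇ toℕ j) then (entry A i j ℤ.* entry A i′ j′) ∷ [] else []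

νterm : ∀ {n} → Matrix n → Fin n → Fin n → Fin n → Fin n → ℤ
νterm A i i′ j j′ = sumℤ (νcell A i i′ j j′)

νASM-∑ : ∀ {n} (A : Matrix n) → νASM A ≡ ∑ (λ i → ∑ (λ i′ → ∑ (λ j → ∑ (λ j′ → νterm A i i′ j j′))))
νASM-∑ {n} A =
  trans (collapse (λ i → concatMap (λ i′ → concatMap (λ j → concatMap (νcell A i i′ j) (L.allFin n)) (L.allFin n)) (L.allFin n)))
  (sum-cong-≗ (λ i → trans (collapse (λ i′ → concatMap (λ j → concatMap (νcell A i i′ j) (L.allFin n)) (L.allFin n)))
  (sum-cong-≗ (λ i′ → trans (collapse (λ j → concatMap (νcell A i i′ j) (L.allFin n)))
  (sum-cong-≗ (λ j → collapse (νcell A i i′ j)))))))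
  where
    collapse : (f : Fin n → List ℤ) → sumℤ (concatMap f (L.allFin n)) ≡ ∑ (sumℤ ∘ f)
    collapse f = sumℤ-concatMap-tabulate f id

νterm≡0 : ∀ {n} (A : Matrix n) i i′ j j′ →
          (toℕ i <ᵇ toℕ i′) ≡ false ⊎ (toℕ j′ ≤ᵇ toℕ j) ≡ false ⊎ entry A i j ℤ.* entry A i′ j′ ≡ 0ℤ →
          νterm A i i′ j j′ ≡ 0ℤ
νterm≡0 A i i′ j j′ = vanish (toℕ i <ᵇ toℕ i′) (toℕ j′ ≤ᵇ toℕ j) (entry A i j ℤ.* entry A i′ j′)
  where
    vanish : ∀ b b′ v → b ≡ false ⊎ b′ ≡ false ⊎ v ≡ 0ℤ → sumℤ (if b ∧ b′ then v ∷ [] else []) ≡ 0ℤ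
    vanish false _ _ _ = refl
    vanish true false _ _ = refl
    vanish true true v (inj₂ (inj₂ refl)) = refl

module ExtensionWeights (k : ℕ) where
  open Extension k

  entry-extend-inner : ∀ B i j → entry (extend B) (inject₁ i) (inject₁ j) ≡ entry B i j
  entry-extend-inner B i j = begin
      V.lookup (V.lookup (V.map (_∷ʳ 0ℤ) B ∷ʳ lastRow) (inject₁ i)) (inject₁ j)
    ≡⟨ cong (λ row → V.lookup row (inject₁ j))
            (trans (lookup-∷ʳ-inject₁ (V.map (_∷ʳ 0ℤ) B) lastRow i) (VP.lookup-map i (_∷ʳ 0ℤ) B)) ⟩
      V.lookup (V.lookup B i ∷ʳ 0ℤ) (inject₁ j)
    ≡⟨ lookup-∷ʳ-inject₁ (V.lookup B i) 0ℤ j ⟩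
      entry B i j
    ∎ where open ≡-Reasoning

  entry-extend-lastColumn : ∀ B i → entry (extend B) (inject₁ i) (fromℕ k) ≡ 0ℤ
  entry-extend-lastColumn B i =
    trans (cong (λ row → V.lookup row (fromℕ k))
                (trans (lookup-∷ʳ-inject₁ (V.map (_∷ʳ 0ℤ) B) lastRow i) (VP.lookup-map i (_∷ʳ 0ℤ) B)))
          (lookup-∷ʳ-last (V.lookup B i) 0ℤ)

  entry-extend-lastRow : ∀ B j → entry (extend B) (fromℕ k) (inject₁ j) ≡ 0ℤ
  entry-extend-lastRow B j =
    trans (cong (λ row → V.lookup row (inject₁ j)) (lookup-∷ʳ-last (V.map (_∷ʳ 0ℤ) B) lastRow))
          (trans (lookup-∷ʳ-inject₁ (zeros k) 1ℤ j) (VP.lookup-replicate j 0ℤ))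

  last≮ : ∀ (i : Fin (suc k)) → (toℕ (fromℕ k) <ᵇ toℕ i) ≡ false
  last≮ i = ⌊⌋-false (_ ℕ.<? toℕ i) (λ k<i → ℕP.≤⇒≯ (FinP.toℕ≤pred[n] i) (subst (ℕ._< toℕ i) (FinP.toℕ-fromℕ k) k<i))

  last≰inner : ∀ (j : Fin k) → (toℕ (fromℕ k) ≤ᵇ toℕ (inject₁ j)) ≡ false
  last≰inner j = ⌊⌋-false (_ ℕ.≤? toℕ (inject₁ j))
    (λ k≤j → ℕP.<⇒≱ (FinP.toℕ<n j) (subst₂ ℕ._≤_ (FinP.toℕ-fromℕ k) (FinP.toℕ-inject₁ j) k≤j))

  *≡0ˡ : ∀ {a} b → a ≡ 0ℤ → a ℤ.* b ≡ 0ℤ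
  *≡0ˡ b refl = ℤP.*-zeroˡ b

  *≡0ʳ : ∀ a {b} → b ≡ 0ℤ → a ℤ.* b ≡ 0ℤ
  *≡0ʳ a refl = ℤP.*-zeroʳ a

  -- Every term of ν(extend B) touching the last row or column vanishes: either its index
  -- condition fails or it contains a zero entry of that row or column.
  νterm-i-last : ∀ B i′ j j′ → νterm (extend B) (fromℕ k) i′ j j′ ≡ 0ℤ
  νterm-i-last B i′ j j′ = νterm≡0 (extend B) (fromℕ k) i′ j j′ (inj₁ (last≮ i′))

  νterm-i′-last : ∀ B i j j′ → νterm (extend B) (inject₁ i) (fromℕ k) j j′ ≡ 0ℤ
  νterm-i′-last B i j j′ with lastView j′
  ... | inner j₀ = νterm≡0 (extend B) (inject₁ i) (fromℕ k) j (inject₁ j₀) (inj₂ (inj₂ (*≡0ʳ (entry (extend B) (inject₁ i) j) (entry-extend-lastRow B j₀))))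
  ... | last with lastView j
  ...   | inner j₁ = νterm≡0 (extend B) (inject₁ i) (fromℕ k) (inject₁ j₁) (fromℕ k) (inj₂ (inj₁ (last≰inner j₁)))
  ...   | last = νterm≡0 (extend B) (inject₁ i) (fromℕ k) (fromℕ k) (fromℕ k) (inj₂ (inj₂ (*≡0ˡ (entry (extend B) (fromℕ k) (fromℕ k)) (entry-extend-lastColumn B i))))

  νterm-j-last : ∀ B i i′ j′ → νterm (extend B) (inject₁ i) (inject₁ i′) (fromℕ k) j′ ≡ 0ℤ
  νterm-j-last B i i′ j′ = νterm≡0 (extend B) (inject₁ i) (inject₁ i′) (fromℕ k) j′ (inj₂ (inj₂ (*≡0ˡ _ (entry-extend-lastColumn B i))))

  νterm-j′-last : ∀ B i i′ j → νterm (extend B) (inject₁ i) (inject₁ i′) (inject₁ j) (fromℕ k) ≡ 0ℤ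
  νterm-j′-last B i i′ j = νterm≡0 (extend B) (inject₁ i) (inject₁ i′) (inject₁ j) (fromℕ k) (inj₂ (inj₁ (last≰inner j)))

  νterm-inner : ∀ B i i′ j j′ → νterm (extend B) (inject₁ i) (inject₁ i′) (inject₁ j) (inject₁ j′) ≡ νterm B i i′ j j′
  νterm-inner B i i′ j j′ = cong₂ (λ b v → sumℤ (if b then v ∷ [] else []))
    (cong₂ _∧_ (cong₂ _<ᵇ_ (FinP.toℕ-inject₁ i) (FinP.toℕ-inject₁ i′)) (cong₂ _≤ᵇ_ (FinP.toℕ-inject₁ j′) (FinP.toℕ-inject₁ j)))
    (cong₂ ℤ._*_ (entry-extend-inner B i j) (entry-extend-inner B i′ j′))

  νASM-extend : ∀ B → νASM (extend B) ≡ νASM B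
  νASM-extend B = trans (νASM-∑ (extend B)) (trans level₁ (sym (νASM-∑ B)))
    where
      level₄ : ∀ i i′ j → ∑ (νterm (extend B) (inject₁ i) (inject₁ i′) (inject₁ j)) ≡ ∑ (νterm B i i′ j)
      level₄ i i′ j = trans (∑-last-zero (νterm (extend B) (inject₁ i) (inject₁ i′) (inject₁ j)) (νterm-j′-last B i i′ j)) (sum-cong-≗ (νterm-inner B i i′ j))
      level₃ : ∀ i i′ → ∑ (λ j → ∑ (νterm (extend B) (inject₁ i) (inject₁ i′) j)) ≡ ∑ (λ j → ∑ (νterm B i i′ j))
      level₃ i i′ = trans (∑-last-zero (λ j → ∑ (νterm (extend B) (inject₁ i) (inject₁ i′) j)) (∑-zero (νterm-j-last B i i′))) (sum-cong-≗ (level₄ i i′))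
      level₂ : ∀ i → ∑ (λ i′ → ∑ (λ j → ∑ (νterm (extend B) (inject₁ i) i′ j)))
                   ≡ ∑ (λ i′ → ∑ (λ j → ∑ (νterm B i i′ j)))
      level₂ i = trans (∑-last-zero (λ i′ → ∑ (λ j → ∑ (νterm (extend B) (inject₁ i) i′ j)))
                        (∑-zero (λ j → ∑-zero (νterm-i′-last B i j)))) (sum-cong-≗ (level₃ i))
      level₁ : ∑ (λ i → ∑ (λ i′ → ∑ (λ j → ∑ (νterm (extend B) i i′ j))))
               ≡ ∑ (λ i → ∑ (λ i′ → ∑ (λ j → ∑ (νterm B i i′ j))))
      level₁ = trans (∑-last-zero (λ i → ∑ (λ i′ → ∑ (λ j → ∑ (νterm (extend B) i i′ j))))
                       (∑-zero (λ i′ → ∑-zero (λ j → ∑-zero (νterm-i-last B i′ j))))) (sum-cong-≗ level₂)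

  minusOnes : ∀ {n} → Vec ℤ n → ℕ
  minusOnes r = countᵇ (_==ℤ -1ℤ) (V.toList r)

  minusOnes-∷ʳ-0 : ∀ {n} (r : Vec ℤ n) → minusOnes (r ∷ʳ 0ℤ) ≡ minusOnes r
  minusOnes-∷ʳ-0 r = trans (cong (countᵇ (_==ℤ -1ℤ)) (VP.toList-∷ʳ 0ℤ r))
                          (trans (countᵇ-++ (_==ℤ -1ℤ) (V.toList r) (0ℤ ∷ [])) (ℕP.+-identityʳ _))

  minusOnes-lastRow : minusOnes lastRow ≡ 0
  minusOnes-lastRow = trans (cong (countᵇ (_==ℤ -1ℤ)) (trans (VP.toList-∷ʳ 1ℤ (zeros k)) (cong (_++ 1ℤ ∷ []) (VP.toList-replicate k 0ℤ))))
                            (none k)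
    where
      none : ∀ n → countᵇ (_==ℤ -1ℤ) (L.replicate n 0ℤ L.∷ʳ 1ℤ) ≡ 0
      none zero = refl
      none (suc n) = none n

  μASM-extend : ∀ B → μASM (extend B) ≡ μASM B
  μASM-extend B = begin
      sum (map minusOnes (V.toList (V.map (_∷ʳ 0ℤ) B ∷ʳ lastRow)))
    ≡⟨ cong (sum ∘ map minusOnes) (VP.toList-∷ʳ lastRow (V.map (_∷ʳ 0ℤ) B)) ⟩
      sum (map minusOnes (V.toList (V.map (_∷ʳ 0ℤ) B) L.∷ʳ lastRow))
    ≡⟨ cong sum (LP.map-++ minusOnes (V.toList (V.map (_∷ʳ 0ℤ) B)) (lastRow ∷ [])) ⟩
      sum (map minusOnes (V.toList (V.map (_∷ʳ 0ℤ) B)) L.∷ʳ minusOnes lastRow)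
    ≡⟨ ℕLP.sum-++ (map minusOnes (V.toList (V.map (_∷ʳ 0ℤ) B))) (minusOnes lastRow ∷ []) ⟩
      sum (map minusOnes (V.toList (V.map (_∷ʳ 0ℤ) B))) + (minusOnes lastRow + 0)
    ≡⟨ cong₂ _+_ rows (cong (_+ 0) minusOnes-lastRow) ⟩
      sum (map minusOnes (V.toList B)) + 0
    ≡⟨ ℕP.+-identityʳ _ ⟩
      sum (map minusOnes (V.toList B))
    ∎ where
      open ≡-Reasoning
      rows : sum (map minusOnes (V.toList (V.map (_∷ʳ 0ℤ) B))) ≡ sum (map minusOnes (V.toList B))
      rows = cong sum (trans (cong (map minusOnes) (VP.toList-map (_∷ʳ 0ℤ) B))
                      (trans (sym (LP.map-∘ (V.toList B))) (LP.map-cong minusOnes-∷ʳ-0 (V.toList B))))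

module ASMSpecialisation (m : ℕ) where
  open Extension (suc m)

  ρ₁ASM-extend : ∀ B → SignRows B → isASM B ≡ true → ρ₁ASM (extend B) ≡ ρ₁ASM B
  ρ₁ASM-extend (b V.∷ B) (sb ∷ _) asm =
    trans (cong zerosBeforeOne (VP.toList-∷ʳ 0ℤ b))
          (zerosBeforeOne-∷ʳ-0 (V.toList b) sb (proj₁ (∧-true⁻ (goodLine (V.toList b)) (proj₁ (∧-true⁻ (rowsGood (b V.∷ B)) asm)))))

  ASM-sign-rows : All (λ B → SignRows B × isASM B ≡ true) (ASM (suc m))
  ASM-sign-rows = All.zip (AllP.filter⁺ (T? ∘ isASM) (vecsOver-All (vecsOver-All signs-IsSign (suc m)) (suc m)) ,
                           all-filterᵇ isASM (allSignMatrices (suc m)))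

  ZASM-specialise : ∀ x y z → ZASM (suc m) x y z 1ℤ ≡ ZASM (suc (suc m)) x y z 0ℤ
  ZASM-specialise x y z =
    sumℤ-specialise weight weight ρ₂ASM ρ₂ASM extend (ASM (suc m)) (ASM (suc (suc m)))
      (trans (filterᵇ-filterᵇ (λ A → ρ₂ASM A == 0) isASM (allSignMatrices (suc (suc m)))) ASM-ρ₂≡0)
      (All.map (λ {B} (sB , asm) → cong₂ ℤ._*_ (cong₂ ℤ._*_ (cong (λ ν → x ℤ.^ ℤ.∣ ν ∣) (νASM-extend B))
                                                            (cong (y ℤ.^_) (μASM-extend B)))
                                               (cong (z ℤ.^_) (ρ₁ASM-extend B sB asm)))
               ASM-sign-rows)
    where
      open ExtensionWeights (suc m)
      weight : ∀ {n} → Matrix n → ℤ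
      weight A = x ℤ.^ ℤ.∣ νASM A ∣ ℤ.* y ℤ.^ μASM A ℤ.* z ℤ.^ ρ₁ASM A

mainTheorem4 : (n : ℕ) → 2 ≤ n → (x y z : ℤ) →
    (ZASM (n ∸ 1) x y z 1ℤ ≡ ZASM n x y z 0ℤ) × (ZDPP (n ∸ 1) x y z 1ℤ ≡ ZDPP n x y z 0ℤ)
mainTheorem4 (suc (suc m)) (s≤s (s≤s z≤n)) x y z = ASMSpecialisation.ZASM-specialise m x y z , Bump.ZDPP-specialise m x y z
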